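{- Let $r\ge1$ and $k\ge1$ be integers and let $w$ be an $\mathbf a\mathbf b$-word of degree $k-1$. Then, as formal power series in $x$ with coefficients in $\mathbb Q(q)$, $$\sum_{n\ge0}(-1)^n\,\beta_q\big((\mathbf a^{r-1}\mathbf b)^n w\big)\frac{x^{rn+k}}{[rn+k]!}=\frac{\sum_{n\ge0}\beta_q(\mathbf a^{rn}w)\frac{x^{rn+k}}{[rn+k]!}}{\sum_{n\ge0}\frac{x^{rn}}{[rn]!}}.$$
   Context: An $\mathbf a\mathbf b$-word of degree $n-1$ is a word of length $n-1$ in the letters $\mathbf a,\mathbf b$; exponents denote repetition and juxtaposition denotes concatenation. The descent word of $\sigma=\sigma_1\cdots\sigma_n\in\mathfrak S_n$ is the word $u_1\cdots u_{n-1}$ with $u_i=\mathbf a$ if $\sigma_i<\sigma_{i+1}$ and $u_i=\mathbf b$ otherwise. For a word $u$ of degree $n-1$, $\beta_q(u)=\sum_\sigma q^{\mathrm{inv}(\sigma)}$, summed over $\sigma\in\mathfrak S_n$ with descent word $u$, where $\mathrm{inv}(\sigma)=\#\{i<j:\sigma_i>\sigma_j\}$. $[n]=1+q+\cdots+q^{n-1}$, $[n]!=[1][2]\cdots[n]$, $[0]!=1$. -}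

module Defs where

open import Data.Bool using (Bool; true; false; if_then_else_; _∧_)
open import Data.Nat using (ℕ; zero; suc; _+_; _*_; _∸_; _<ᵇ_; _≡ᵇ_)
open import Data.Integer using (ℤ; +_; -_) renaming (_+_ to _+ℤ_; _*_ to _*ℤ_)
open import Data.List using (List; []; _∷_; _++_; map; foldr; replicate; concatMap; concat; length; upTo)
open import Data.Product using (_×_)
open import Data.Unit using (⊤)
open import Relation.Binary.PropositionalEquality using (_≡_)

data Letter : Set where
  𝐚 𝐛 : Letter

Word : Set
Word = List Letter

eqLetter : Letter → Letter → Bool
eqLetter 𝐚 𝐚 = true
eqLetter 𝐛 𝐛 = true
eqLetter _ _ = false

eqWord : Word → Word → Bool
eqWord [] [] = true
eqWord (x ∷ xs) (y ∷ ys) = eqLetter x y ∧ eqWord xs ys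
eqWord _ _ = false

wpow : Word → ℕ → Word
wpow u n = concat (replicate n u)

-- permutations of {1,…,n} as lists σ₁⋯σₙ (each listed exactly once)

insertAll : ℕ → List ℕ → List (List ℕ)
insertAll x [] = (x ∷ []) ∷ []
insertAll x (y ∷ ys) = (x ∷ y ∷ ys) ∷ map (y ∷_) (insertAll x ys)

perms : ℕ → List (List ℕ)
perms zero = [] ∷ []
perms (suc n) = concatMap (insertAll (suc n)) (perms n)

desWord : List ℕ → Word
desWord (x ∷ y ∷ rest) = (if x <ᵇ y then 𝐚 else 𝐛) ∷ desWord (y ∷ rest)
desWord _ = []

countLess : ℕ → List ℕ → ℕ
countLess x [] = 0
countLess x (y ∷ ys) = (if y <ᵇ x then 1 else 0) + countLess x ys

inv : List ℕ → ℕ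
inv [] = 0
inv (x ∷ xs) = countLess x xs + inv xs

-- polynomials in q with integer coefficients (lowest degree first)

Poly : Set
Poly = List ℤ

padd : Poly → Poly → Poly
padd [] q = q
padd (x ∷ xs) [] = x ∷ xs
padd (x ∷ xs) (y ∷ ys) = (x +ℤ y) ∷ padd xs ys

pmul : Poly → Poly → Poly
pmul [] q = []
pmul (x ∷ xs) q = padd (map (x *ℤ_) q) (+ 0 ∷ pmul xs q)

pneg : Poly → Poly
pneg = map -_

IsZeroPoly : Poly → Set
IsZeroPoly [] = ⊤
IsZeroPoly (x ∷ xs) = (x ≡ + 0) × IsZeroPoly xs

mono : ℕ → Poly
mono m = replicate m (+ 0) ++ (+ 1 ∷ [])

-- The field ℚ(q) is represented through its subring of fractions p / d
-- with p, d ∈ ℤ[q] and d(0) = 1.  A denominator d = 1 + q·t is stored by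
-- its "tail" t (as a list of coefficients, d = +1 ∷ t).  All quantities
-- of the statement live in this subring, and equality is the equality
-- of ℚ(q) (cross-multiplication).

record Frac : Set where
  constructor _//_
  field
    num   : Poly
    dtail : Poly

open Frac public

den : Frac → Poly
den f = + 1 ∷ dtail f

-- (1 + q s)(1 + q t) = 1 + q (s + t + q s t)
dmul : Poly → Poly → Poly
dmul s t = padd s (padd t (+ 0 ∷ pmul s t))

infixl 6 _+Q_
infixl 7 _*Q_
infix 4 _≈Q_

_+Q_ : Frac → Frac → Frac
f +Q g = padd (pmul (num f) (den g)) (pmul (num g) (den f)) // dmul (dtail f) (dtail g)

_*Q_ : Frac → Frac → Frac
f *Q g = pmul (num f) (num g) // dmul (dtail f) (dtail g)

-Q_ : Frac → Frac
-Q f = pneg (num f) // dtail f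

0Q 1Q : Frac
0Q = [] // []
1Q = (+ 1 ∷ []) // []

polyQ : Poly → Frac
polyQ p = p // []

_≈Q_ : Frac → Frac → Set
f ≈Q g = IsZeroPoly (padd (pmul (num f) (den g)) (pneg (pmul (num g) (den f))))

sumQ : List Frac → Frac
sumQ = foldr _+Q_ 0Q

signQ : ℕ → Frac → Frac
signQ zero f = f
signQ (suc n) f = -Q (signQ n f)

-- [m+1] = 1 + q + ⋯ + q^m = 1 + q·(1 + ⋯ + q^(m-1))
qintSucTail : ℕ → Poly
qintSucTail m = replicate m (+ 1)

qfactTail : ℕ → Poly
qfactTail zero = []
qfactTail (suc m) = dmul (qfactTail m) (qintSucTail m)

divQFact : Frac → ℕ → Frac
divQFact f m = num f // dmul (dtail f) (qfactTail m)

betaPoly : Word → Poly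
betaPoly u =
  foldr (λ σ acc → if eqWord (desWord σ) u then padd (mono (inv σ)) acc else acc)
        [] (perms (suc (length u)))

βq : Word → Frac
βq u = polyQ (betaPoly u)

-- formal power series in x over ℚ(q)

Series : Set
Series = ℕ → Frac

infix 4 _≋_
_≋_ : Series → Series → Set
A ≋ B = ∀ N → A N ≈Q B N

-- Σ_{n ≥ 0} c n · x^(e n), for an exponent map with e n ≥ n
-- (coefficient of x^N collects all n ≤ N with e n = N)
sparse : (ℕ → ℕ) → (ℕ → Frac) → Series
sparse e c N = sumQ (map (λ n → if e n ≡ᵇ N then c n else 0Q) (upTo (suc N)))

_⊛_ : Series → Series → Series
(A ⊛ B) N = sumQ (map (λ i → A i *Q B (N ∸ i)) (upTo (suc N)))

-- multiplicative inverse of a series C with C 0 = 1: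
-- D 0 = 1,  D N = - Σ_{i=1}^{N} C i · D (N - i).
-- invRev C N = D N ∷ D (N-1) ∷ ⋯ ∷ D 0
zipSum : List Frac → List Frac → Frac
zipSum (x ∷ xs) (y ∷ ys) = x *Q y +Q zipSum xs ys
zipSum _ _ = 0Q

invRev : Series → ℕ → List Frac
invRev C zero = 1Q ∷ []
invRev C (suc N) =
  (-Q zipSum (map (λ j → C (suc j)) (upTo (suc N))) (invRev C N)) ∷ invRev C N

headQ : List Frac → Frac
headQ [] = 0Q
headQ (x ∷ _) = x

inv1 : Series → Series
inv1 C N = headQ (invRev C N)

-- B / C  for a series C with constant term 1
_⊘_ : Series → Series → Series
B ⊘ C = B ⊛ inv1 C

module Submission where

-- The fractions of Defs all have denominators 1 + q·t, which are units of
-- ℤ[[q]]; `ev` maps ℚ(q)-fractions faithfully into ℤ[[q]], so we prove the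
-- identity for power series in x over ℤ[[q]].  Writing L, B, C for the three
-- series, it suffices to show L · C = B, as C has constant term 1.  Both sides
-- are sparse with exponents rM + k; cleared of [rM + k]!, the coefficient of
-- x^(rM+k) is an alternating sum that telescopes by the recurrence
--   β(𝐚^(j+1) W) + β(𝐚^j 𝐛 W) = β(W) · [j + |W| + 2 choose j + 1],
-- proved by counting permutations whose descent word matches 𝐚^j ∗ W, where
-- ∗ is a wildcard, via insertion of the largest value.

open import Level using (0ℓ)
open import Algebra using (CommutativeRing)
open import Function using (_∘_)
open import Data.Bool using (Bool; true; false; if_then_else_; _∧_)
import Data.Bool.Properties as BoolP
open import Data.Nat using (ℕ; zero; suc; _∸_; _≤_; _<_; z≤n; s≤s; _≡ᵇ_; _<ᵇ_)
open import Data.Nat using () renaming (_+_ to _+ℕ_; _*_ to _*ℕ_)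
import Data.Nat.Properties as ℕP
open import Data.Integer as ℤ using (ℤ; +_)
import Data.Integer.Properties as ℤP
open import Data.List using (List; []; _∷_; _++_; map; replicate; length; foldr; concatMap; applyUpTo; upTo)
import Data.List.Properties as ListP
open import Data.List.Relation.Unary.All as All using (All; []; _∷_)
import Data.List.Relation.Unary.All.Properties as AllP
open import Data.Maybe using (Maybe; just; nothing)
open import Data.Product using (_,_; _×_; proj₁; proj₂)
open import Data.Unit using (tt)
open import Relation.Binary.PropositionalEquality as P using (_≡_)
open import Relation.Nullary using (Dec; yes; no)
open import Defs

≡ᵇ-sym : ∀ m n → (m ≡ᵇ n) ≡ (n ≡ᵇ m)
≡ᵇ-sym zero    zero    = P.refl
≡ᵇ-sym zero    (suc n) = P.refl
≡ᵇ-sym (suc m) zero    = P.refl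
≡ᵇ-sym (suc m) (suc n) = ≡ᵇ-sym m n

≡ᵇ-shift : ∀ i j N → i ≤ N → (i +ℕ j ≡ᵇ N) ≡ (j ≡ᵇ N ∸ i)
≡ᵇ-shift zero    j N       _         = P.refl
≡ᵇ-shift (suc i) j (suc N) (s≤s i≤N) = ≡ᵇ-shift i j N i≤N

≡ᵇ-> : ∀ m N → N < m → (m ≡ᵇ N) ≡ false
≡ᵇ-> (suc m) zero    _         = P.refl
≡ᵇ-> (suc m) (suc N) (s≤s N<m) = ≡ᵇ-> m N N<m

<ᵇ-true : ∀ a T → a < T → (a <ᵇ T) ≡ true
<ᵇ-true zero    (suc T) _         = P.refl
<ᵇ-true (suc a) (suc T) (s≤s a<T) = <ᵇ-true a T a<T

<ᵇ-false : ∀ a T → T ≤ a → (a <ᵇ T) ≡ false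
<ᵇ-false a       zero    _         = P.refl
<ᵇ-false (suc a) (suc T) (s≤s T≤a) = <ᵇ-false a T T≤a

module FiniteSums {c ℓ} (R : CommutativeRing c ℓ) where
  open CommutativeRing R
  open import Relation.Binary.Reasoning.Setoid setoid
  open import Algebra.Properties.Ring ring using (-‿+-comm; -0#≈0#; -‿distribˡ-*)
  open import Algebra.Properties.CommutativeSemigroup +-commutativeSemigroup using (interchange)

  Σ : ℕ → (ℕ → Carrier) → Carrier
  Σ zero    f = 0#
  Σ (suc n) f = f 0 + Σ n (λ i → f (suc i))

  δ : ℕ → ℕ → Carrier
  δ i j = if i ≡ᵇ j then 1# else 0#

  δ-sym : ∀ i j → δ i j ≡ δ j i
  δ-sym i j = P.cong (λ b → if b then 1# else 0#) (≡ᵇ-sym i j)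

  Σ-cong : ∀ n {f g} → (∀ i → i < n → f i ≈ g i) → Σ n f ≈ Σ n g
  Σ-cong zero    h = refl
  Σ-cong (suc n) h = +-cong (h 0 (s≤s z≤n)) (Σ-cong n (λ i i<n → h (suc i) (s≤s i<n)))

  Σ-cong′ : ∀ n {f g} → (∀ i → f i ≈ g i) → Σ n f ≈ Σ n g
  Σ-cong′ n h = Σ-cong n (λ i _ → h i)

  Σ-0 : ∀ n {f} → (∀ i → i < n → f i ≈ 0#) → Σ n f ≈ 0#
  Σ-0 zero    h = refl
  Σ-0 (suc n) h = trans (+-cong (h 0 (s≤s z≤n)) (Σ-0 n (λ i i<n → h (suc i) (s≤s i<n)))) (+-identityˡ 0#)

  Σ-+ : ∀ n (f g : ℕ → Carrier) → Σ n (λ i → f i + g i) ≈ Σ n f + Σ n g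
  Σ-+ zero    f g = sym (+-identityˡ 0#)
  Σ-+ (suc n) f g = trans (+-congˡ (Σ-+ n (λ i → f (suc i)) (λ i → g (suc i))))
                          (interchange (f 0) (g 0) _ _)

  Σ-*ˡ : ∀ n c (f : ℕ → Carrier) → c * Σ n f ≈ Σ n (λ i → c * f i)
  Σ-*ˡ zero    c f = zeroʳ c
  Σ-*ˡ (suc n) c f = trans (distribˡ c _ _) (+-congˡ (Σ-*ˡ n c (λ i → f (suc i))))

  Σ-*ʳ : ∀ n c (f : ℕ → Carrier) → Σ n f * c ≈ Σ n (λ i → f i * c)
  Σ-*ʳ n c f = trans (*-comm _ c) (trans (Σ-*ˡ n c f) (Σ-cong′ n (λ i → *-comm c (f i))))

  Σ-neg : ∀ n (f : ℕ → Carrier) → - Σ n f ≈ Σ n (λ i → - f i)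
  Σ-neg zero    f = -0#≈0#
  Σ-neg (suc n) f = trans (sym (-‿+-comm _ _)) (+-congˡ (Σ-neg n (λ i → f (suc i))))

  Σ-last : ∀ n (f : ℕ → Carrier) → Σ (suc n) f ≈ Σ n f + f n
  Σ-last zero    f = trans (+-identityʳ _) (sym (+-identityˡ _))
  Σ-last (suc n) f = trans (+-congˡ (Σ-last n (λ i → f (suc i)))) (sym (+-assoc _ _ _))

  Σ-split : ∀ m n (f : ℕ → Carrier) → Σ (m +ℕ n) f ≈ Σ m f + Σ n (λ i → f (m +ℕ i))
  Σ-split zero    n f = sym (+-identityˡ _)
  Σ-split (suc m) n f = trans (+-congˡ (Σ-split m n (λ i → f (suc i)))) (sym (+-assoc _ _ _))

  Σ-extend : ∀ n k (f : ℕ → Carrier) → (∀ i → f (n +ℕ i) ≈ 0#) → Σ (n +ℕ k) f ≈ Σ n f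
  Σ-extend n k f h = trans (Σ-split n k f) (trans (+-congˡ (Σ-0 k (λ i _ → h i))) (+-identityʳ _))

  Σ-swap : ∀ n m (f : ℕ → ℕ → Carrier) →
           Σ n (λ i → Σ m (λ j → f i j)) ≈ Σ m (λ j → Σ n (λ i → f i j))
  Σ-swap zero    m f = sym (Σ-0 m (λ _ _ → refl))
  Σ-swap (suc n) m f = trans (+-congˡ (Σ-swap n m (λ i j → f (suc i) j)))
                             (sym (Σ-+ m (λ j → f 0 j) (λ j → Σ n (λ i → f (suc i) j))))

  Σ-δ : ∀ n j (f : ℕ → Carrier) → j < n → Σ n (λ i → δ i j * f i) ≈ f j
  Σ-δ (suc n) zero    f _ = trans (+-cong (*-identityˡ _) (Σ-0 n (λ i _ → zeroˡ _))) (+-identityʳ _)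
  Σ-δ (suc n) (suc j) f (s≤s j<n) = trans (+-cong (zeroˡ _) (Σ-δ n j (λ i → f (suc i)) j<n)) (+-identityˡ _)

  Σ-δ-out : ∀ n j (f : ℕ → Carrier) → n ≤ j → Σ n (λ i → δ i j * f i) ≈ 0#
  Σ-δ-out zero    j       f _         = refl
  Σ-δ-out (suc n) (suc j) f (s≤s n≤j) = trans (+-cong (zeroˡ _) (Σ-δ-out n j (λ i → f (suc i)) n≤j)) (+-identityˡ _)

  when : Bool → Carrier → Carrier
  when b x = if b then x else 0#

  below : ℕ → ℕ → Carrier → Carrier
  below T a x = when (a <ᵇ T) x

  when-cong : ∀ b {x y} → x ≈ y → when b x ≈ when b y
  when-cong true  x≈y = x≈y
  when-cong false _   = refl

  when-*ʳ : ∀ b x y → when b x * y ≈ when b (x * y)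
  when-*ʳ true  x y = refl
  when-*ʳ false x y = zeroˡ y

  below-true : ∀ T a x → a < T → below T a x ≈ x
  below-true T a x a<T rewrite <ᵇ-true a T a<T = refl

  below-false : ∀ T a x → T ≤ a → below T a x ≈ 0#
  below-false T a x T≤a rewrite <ᵇ-false a T T≤a = refl

  below-*ˡ : ∀ T a c x → c * below T a x ≈ below T a (c * x)
  below-*ˡ T a c x with a <ᵇ T
  ... | true  = refl
  ... | false = zeroʳ c

  Σ-δ-select : ∀ T a (F : ℕ → Carrier) → Σ T (λ s → δ a s * F s) ≈ below T a (F a)
  Σ-δ-select T a F = trans (Σ-cong′ T (λ s → reflexive (P.cong (_* F s) (δ-sym a s)))) (pick (a ℕP.<? T))
    where
    pick : Dec (a < T) → Σ T (λ s → δ s a * F s) ≈ below T a (F a)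
    pick (yes a<T) = trans (Σ-δ T a F a<T) (sym (below-true T a (F a) a<T))
    pick (no  a≮T) = trans (Σ-δ-out T a F (ℕP.≮⇒≥ a≮T)) (sym (below-false T a (F a) (ℕP.≮⇒≥ a≮T)))

  sign : ℕ → Carrier
  sign zero    = 1#
  sign (suc n) = - sign n

  telescope : ∀ M (a : ℕ → Carrier) → Σ M (λ n → sign n * (a n + a (suc n))) + sign M * a M ≈ a 0
  telescope zero    a = trans (+-identityˡ _) (*-identityˡ (a 0))
  telescope (suc M) a = begin
    (1# * (a 0 + a 1) + Σ M (λ n → (- sign n) * (a (suc n) + a (suc (suc n))))) + (- sign M) * a (suc M)
      ≈⟨ +-cong (+-cong (*-identityˡ (a 0 + a 1))
                        (trans (Σ-cong′ M (λ n → sym (-‿distribˡ-* (sign n) (a (suc n) + a (suc (suc n))))))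
                               (sym (Σ-neg M (λ n → sign n * (a (suc n) + a (suc (suc n))))))))
                (sym (-‿distribˡ-* (sign M) (a (suc M)))) ⟩
    ((a 0 + a 1) + - S) + - t ≈⟨ +-assoc (a 0 + a 1) (- S) (- t) ⟩
    (a 0 + a 1) + (- S + - t) ≈⟨ +-congˡ (-‿+-comm S t) ⟩
    (a 0 + a 1) + - (S + t)   ≈⟨ +-congˡ (-‿cong (telescope M (λ n → a (suc n)))) ⟩
    (a 0 + a 1) + - a 1       ≈⟨ +-assoc (a 0) (a 1) (- a 1) ⟩
    a 0 + (a 1 + - a 1)       ≈⟨ +-congˡ (-‿inverseʳ (a 1)) ⟩
    a 0 + 0#                  ≈⟨ +-identityʳ (a 0) ⟩
    a 0                       ∎
    where
    S = Σ M (λ n → sign n * (a (suc n) + a (suc (suc n))))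
    t = sign M * a (suc M)

  ΣL : ∀ {A : Set} → List A → (A → Carrier) → Carrier
  ΣL []       f = 0#
  ΣL (x ∷ xs) f = f x + ΣL xs f

  ΣL-cong : ∀ {A : Set} (xs : List A) {f g} → (∀ x → f x ≈ g x) → ΣL xs f ≈ ΣL xs g
  ΣL-cong []       h = refl
  ΣL-cong (x ∷ xs) h = +-cong (h x) (ΣL-cong xs h)

  ΣL-cong-All : ∀ {A : Set} {Q : A → Set} (xs : List A) {f g : A → Carrier} →
                All Q xs → (∀ x → Q x → f x ≈ g x) → ΣL xs f ≈ ΣL xs g
  ΣL-cong-All []       []       h = refl
  ΣL-cong-All (x ∷ xs) (q ∷ qs) h = +-cong (h x q) (ΣL-cong-All xs qs h)

  ΣL-+ : ∀ {A : Set} (xs : List A) (f g : A → Carrier) → ΣL xs (λ x → f x + g x) ≈ ΣL xs f + ΣL xs g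
  ΣL-+ []       f g = sym (+-identityˡ 0#)
  ΣL-+ (x ∷ xs) f g = trans (+-congˡ (ΣL-+ xs f g)) (interchange (f x) (g x) _ _)

  ΣL-++ : ∀ {A : Set} (xs ys : List A) f → ΣL (xs ++ ys) f ≈ ΣL xs f + ΣL ys f
  ΣL-++ []       ys f = sym (+-identityˡ _)
  ΣL-++ (x ∷ xs) ys f = trans (+-congˡ (ΣL-++ xs ys f)) (sym (+-assoc (f x) _ _))

  ΣL-concatMap : ∀ {A B : Set} (g : A → List B) xs f → ΣL (concatMap g xs) f ≈ ΣL xs (λ x → ΣL (g x) f)
  ΣL-concatMap g []       f = refl
  ΣL-concatMap g (x ∷ xs) f = trans (ΣL-++ (g x) (concatMap g xs) f) (+-congˡ (ΣL-concatMap g xs f))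

  ΣL-map : ∀ {A B : Set} (g : A → B) xs f → ΣL (map g xs) f ≈ ΣL xs (λ x → f (g x))
  ΣL-map g []       f = refl
  ΣL-map g (x ∷ xs) f = +-congˡ (ΣL-map g xs f)

  ΣL-Σ : ∀ {A : Set} (xs : List A) n (G : A → ℕ → Carrier) →
         ΣL xs (λ x → Σ n (G x)) ≈ Σ n (λ i → ΣL xs (λ x → G x i))
  ΣL-Σ []       n G = sym (Σ-0 n (λ _ _ → refl))
  ΣL-Σ (x ∷ xs) n G = trans (+-congˡ (ΣL-Σ xs n G)) (sym (Σ-+ n (G x) (λ i → ΣL xs (λ y → G y i))))

  ΣL-when : ∀ {A : Set} (xs : List A) b c (F : A → Carrier) → ΣL xs (λ x → when b (c * F x)) ≈ when b (c * ΣL xs F)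
  ΣL-when []       true  c F = sym (zeroʳ c)
  ΣL-when []       false c F = refl
  ΣL-when (x ∷ xs) true  c F = trans (+-congˡ (ΣL-when xs true c F)) (sym (distribˡ c (F x) _))
  ΣL-when (x ∷ xs) false c F = trans (+-congˡ (ΣL-when xs false c F)) (+-identityˡ 0#)

module Convolution {c ℓ} (R : CommutativeRing c ℓ) where
  open CommutativeRing R
  open FiniteSums R public
  open import Relation.Binary.Reasoning.Setoid setoid
  open import Algebra.Properties.Ring ring using (-‿distribˡ-*; -‿+-comm)

  conv : (ℕ → Carrier) → (ℕ → Carrier) → ℕ → Carrier
  conv f g N = Σ (suc N) (λ i → f i * g (N ∸ i))

  e : ℕ → Carrier
  e i = δ i 0

  Σ²-antidiagonal : ∀ T M (F : ℕ → ℕ → Carrier) → M < T →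
    Σ T (λ i → Σ T (λ j → δ (i +ℕ j) M * F i j)) ≈ Σ (suc M) (λ i → F i (M ∸ i))
  Σ²-antidiagonal T M F M<T = begin
    Σ T H                        ≡⟨ P.cong (λ x → Σ x H) (P.sym (ℕP.m+[n∸m]≡n M<T)) ⟩
    Σ (suc M +ℕ (T ∸ suc M)) H   ≈⟨ Σ-extend (suc M) (T ∸ suc M) H (λ i → beyond (suc M +ℕ i) (s≤s (ℕP.m≤m+n M i))) ⟩
    Σ (suc M) H                  ≈⟨ Σ-cong (suc M) (λ i i<1+M → within i (ℕP.≤-pred i<1+M)) ⟩
    Σ (suc M) (λ i → F i (M ∸ i)) ∎
    where
    H : ℕ → Carrier
    H i = Σ T (λ j → δ (i +ℕ j) M * F i j)
    within : ∀ i → i ≤ M → H i ≈ F i (M ∸ i)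
    within i i≤M = trans (Σ-cong′ T (λ j → reflexive (P.cong (λ b → (if b then 1# else 0#) * F i j) (≡ᵇ-shift i j M i≤M))))
                         (Σ-δ T (M ∸ i) (F i) (ℕP.≤-<-trans (ℕP.m∸n≤m M i) M<T))
    beyond : ∀ i → M < i → H i ≈ 0#
    beyond i M<i = Σ-0 T (λ j _ → trans (reflexive (P.cong (λ b → (if b then 1# else 0#) * F i j)
                                          (≡ᵇ-> (i +ℕ j) M (ℕP.<-≤-trans M<i (ℕP.m≤m+n i j)))))
                                        (zeroˡ (F i j)))

  conv-as-Σ² : ∀ T f g N → N < T → conv f g N ≈ Σ T (λ i → Σ T (λ j → δ (i +ℕ j) N * (f i * g j)))
  conv-as-Σ² T f g N N<T = sym (Σ²-antidiagonal T N (λ i j → f i * g j) N<T)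

  conv-cong : ∀ {f f′ g g′} → (∀ i → f i ≈ f′ i) → (∀ i → g i ≈ g′ i) → ∀ N → conv f g N ≈ conv f′ g′ N
  conv-cong hf hg N = Σ-cong′ (suc N) (λ i → *-cong (hf i) (hg (N ∸ i)))

  conv-comm : ∀ f g N → conv f g N ≈ conv g f N
  conv-comm f g N = begin
    conv f g N
      ≈⟨ conv-as-Σ² (suc N) f g N ℕP.≤-refl ⟩
    Σ (suc N) (λ i → Σ (suc N) (λ j → δ (i +ℕ j) N * (f i * g j)))
      ≈⟨ Σ-swap (suc N) (suc N) (λ i j → δ (i +ℕ j) N * (f i * g j)) ⟩
    Σ (suc N) (λ j → Σ (suc N) (λ i → δ (i +ℕ j) N * (f i * g j)))
      ≈⟨ Σ-cong′ (suc N) (λ j → Σ-cong′ (suc N) (λ i →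
           *-cong (reflexive (P.cong (λ x → δ x N) (ℕP.+-comm i j))) (*-comm (f i) (g j)))) ⟩
    Σ (suc N) (λ j → Σ (suc N) (λ i → δ (j +ℕ i) N * (g j * f i)))
      ≈⟨ sym (conv-as-Σ² (suc N) g f N ℕP.≤-refl) ⟩
    conv g f N ∎

  conv-distribˡ : ∀ f g h N → conv f (λ i → g i + h i) N ≈ conv f g N + conv f h N
  conv-distribˡ f g h N = trans (Σ-cong′ (suc N) (λ i → distribˡ (f i) (g (N ∸ i)) (h (N ∸ i))))
                                (Σ-+ (suc N) (λ i → f i * g (N ∸ i)) (λ i → f i * h (N ∸ i)))

  conv-identityˡ : ∀ f N → conv e f N ≈ f N
  conv-identityˡ f N = Σ-δ (suc N) 0 (λ i → f (N ∸ i)) (s≤s z≤n)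

  -- Both bracketings of a triple product equal the sum of f i * g j * h (N - i - j)
  -- over i, j < N + 1 with i + j ≤ N.
  conv-assoc : ∀ f g h N → conv (conv f g) h N ≈ conv f (conv g h) N
  conv-assoc f g h N = trans left (sym right)
    where
    T = suc N
    K : ℕ → ℕ → Carrier
    K i j = below T (i +ℕ j) (f i * (g j * h (N ∸ (i +ℕ j))))
    left : conv (conv f g) h N ≈ Σ T (λ i → Σ T (K i))
    left = begin
      Σ T (λ s → conv f g s * h (N ∸ s))
        ≈⟨ Σ-cong T (λ s s<T → *-congʳ {h (N ∸ s)} (conv-as-Σ² T f g s s<T)) ⟩
      Σ T (λ s → Σ T (λ i → Σ T (λ j → δ (i +ℕ j) s * (f i * g j))) * h (N ∸ s))
        ≈⟨ Σ-cong′ T (λ s → trans (Σ-*ʳ T (h (N ∸ s)) (λ i → Σ T (λ j → δ (i +ℕ j) s * (f i * g j))))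
             (Σ-cong′ T (λ i → trans (Σ-*ʳ T (h (N ∸ s)) (λ j → δ (i +ℕ j) s * (f i * g j)))
               (Σ-cong′ T (λ j → trans (*-assoc (δ (i +ℕ j) s) (f i * g j) (h (N ∸ s)))
                                       (*-congˡ (*-assoc (f i) (g j) (h (N ∸ s))))))))) ⟩
      Σ T (λ s → Σ T (λ i → Σ T (λ j → δ (i +ℕ j) s * (f i * (g j * h (N ∸ s))))))
        ≈⟨ Σ-swap T T (λ s i → Σ T (λ j → δ (i +ℕ j) s * (f i * (g j * h (N ∸ s))))) ⟩
      Σ T (λ i → Σ T (λ s → Σ T (λ j → δ (i +ℕ j) s * (f i * (g j * h (N ∸ s))))))
        ≈⟨ Σ-cong′ T (λ i → Σ-swap T T (λ s j → δ (i +ℕ j) s * (f i * (g j * h (N ∸ s))))) ⟩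
      Σ T (λ i → Σ T (λ j → Σ T (λ s → δ (i +ℕ j) s * (f i * (g j * h (N ∸ s))))))
        ≈⟨ Σ-cong′ T (λ i → Σ-cong′ T (λ j → Σ-δ-select T (i +ℕ j) (λ s → f i * (g j * h (N ∸ s))))) ⟩
      Σ T (λ i → Σ T (K i)) ∎
    truncate : ∀ i → i ≤ N → Σ T (λ j → below T (i +ℕ j) (g j * h (N ∸ i ∸ j))) ≈ conv g h (N ∸ i)
    truncate i i≤N = begin
      Σ T G                          ≡⟨ P.cong (λ x → Σ x G) (P.sym (P.cong suc (ℕP.m∸n+n≡m i≤N))) ⟩
      Σ (suc (N ∸ i) +ℕ i) G         ≈⟨ Σ-extend (suc (N ∸ i)) i G (λ j → below-false T (i +ℕ (suc (N ∸ i) +ℕ j)) (g (suc (N ∸ i) +ℕ j) * h (N ∸ i ∸ (suc (N ∸ i) +ℕ j))) (outside j)) ⟩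
      Σ (suc (N ∸ i)) G              ≈⟨ Σ-cong (suc (N ∸ i)) (λ j j<T-i → below-true T (i +ℕ j) (g j * h (N ∸ i ∸ j)) (inside j j<T-i)) ⟩
      conv g h (N ∸ i) ∎
      where
      G : ℕ → Carrier
      G j = below T (i +ℕ j) (g j * h (N ∸ i ∸ j))
      i+[T-i] : i +ℕ suc (N ∸ i) ≡ T
      i+[T-i] = P.trans (ℕP.+-suc i (N ∸ i)) (P.cong suc (ℕP.m+[n∸m]≡n i≤N))
      inside : ∀ j → j < suc (N ∸ i) → i +ℕ j < T
      inside j j<T-i = P.subst (i +ℕ j <_) i+[T-i] (ℕP.+-monoʳ-< i j<T-i)
      outside : ∀ j → T ≤ i +ℕ (suc (N ∸ i) +ℕ j)
      outside j = P.subst (_≤ i +ℕ (suc (N ∸ i) +ℕ j)) i+[T-i] (ℕP.+-monoʳ-≤ i (ℕP.m≤m+n (suc (N ∸ i)) j))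
    right : conv f (conv g h) N ≈ Σ T (λ i → Σ T (K i))
    right = Σ-cong T (λ i i<T → begin
      f i * conv g h (N ∸ i)
        ≈⟨ *-congˡ (sym (truncate i (ℕP.≤-pred i<T))) ⟩
      f i * Σ T (λ j → below T (i +ℕ j) (g j * h (N ∸ i ∸ j)))
        ≈⟨ Σ-*ˡ T (f i) (λ j → below T (i +ℕ j) (g j * h (N ∸ i ∸ j))) ⟩
      Σ T (λ j → f i * below T (i +ℕ j) (g j * h (N ∸ i ∸ j)))
        ≈⟨ Σ-cong′ T (λ j → trans (below-*ˡ T (i +ℕ j) (f i) (g j * h (N ∸ i ∸ j)))
             (reflexive (P.cong (λ x → below T (i +ℕ j) (f i * (g j * h x))) (ℕP.∸-+-assoc N i j)))) ⟩
      Σ T (K i) ∎)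

  conv-inverse : ∀ C D → C 0 ≈ 1# → D 0 ≈ 1# →
    (∀ N → D (suc N) ≈ - Σ (suc N) (λ j → C (suc j) * D (N ∸ j))) → ∀ N → conv C D N ≈ e N
  conv-inverse C D C0≈1 D0≈1 rec zero = trans (+-identityʳ (C 0 * D 0)) (trans (*-cong C0≈1 D0≈1) (*-identityˡ 1#))
  conv-inverse C D C0≈1 D0≈1 rec (suc N) = begin
    C 0 * D (suc N) + X ≈⟨ +-congʳ (*-cong C0≈1 (rec N)) ⟩
    1# * (- X) + X      ≈⟨ +-congʳ (*-identityˡ (- X)) ⟩
    - X + X             ≈⟨ -‿inverseˡ X ⟩
    0#                  ∎
    where X = Σ (suc N) (λ j → C (suc j) * D (N ∸ j))

  dot : List Carrier → List Carrier → Carrier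
  dot (x ∷ xs) (y ∷ ys) = x * y + dot xs ys
  dot _        _        = 0#

  inverseList : (ℕ → Carrier) → ℕ → List Carrier
  inverseList C zero    = 1# ∷ []
  inverseList C (suc N) = (- dot (applyUpTo (λ j → C (suc j)) (suc N)) (inverseList C N)) ∷ inverseList C N

  head : List Carrier → Carrier
  head []      = 0#
  head (x ∷ _) = x

  inverse : (ℕ → Carrier) → ℕ → Carrier
  inverse C N = head (inverseList C N)

  inverseList-tabulate : ∀ C N → inverseList C N ≡ applyUpTo (λ j → inverse C (N ∸ j)) (suc N)
  inverseList-tabulate C zero    = P.refl
  inverseList-tabulate C (suc N) = P.cong (inverse C (suc N) ∷_) (inverseList-tabulate C N)

  dot-tabulate : ∀ n (f g : ℕ → Carrier) → dot (applyUpTo f n) (applyUpTo g n) ≈ Σ n (λ j → f j * g j)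
  dot-tabulate zero    f g = refl
  dot-tabulate (suc n) f g = +-congˡ (dot-tabulate n (λ j → f (suc j)) (λ j → g (suc j)))

  inverse-rec : ∀ C N → inverse C (suc N) ≈ - Σ (suc N) (λ j → C (suc j) * inverse C (N ∸ j))
  inverse-rec C N = -‿cong (trans (reflexive (P.cong (dot (applyUpTo (λ j → C (suc j)) (suc N))) (inverseList-tabulate C N)))
                                  (dot-tabulate (suc N) (λ j → C (suc j)) (λ j → inverse C (N ∸ j))))

  infix 4 _≈ₛ_
  _≈ₛ_ : (ℕ → Carrier) → (ℕ → Carrier) → Set ℓ
  f ≈ₛ g = ∀ i → f i ≈ g i

  seriesRing : CommutativeRing c ℓ
  seriesRing = record
    { Carrier = ℕ → Carrier
    ; _≈_ = _≈ₛ_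
    ; _+_ = λ f g i → f i + g i
    ; _*_ = conv
    ; -_ = λ f i → - f i
    ; 0# = λ _ → 0#
    ; 1# = e
    ; isCommutativeRing = record
      { isRing = record
        { +-isAbelianGroup = record
          { isGroup = record
            { isMonoid = record
              { isSemigroup = record
                { isMagma = record
                  { isEquivalence = record { refl = λ i → refl ; sym = λ h i → sym (h i) ; trans = λ h k i → trans (h i) (k i) }
                  ; ∙-cong = λ h k i → +-cong (h i) (k i) }
                ; assoc = λ f g h i → +-assoc (f i) (g i) (h i) }
              ; identity = (λ f i → +-identityˡ (f i)) , (λ f i → +-identityʳ (f i)) }
            ; inverse = (λ f i → -‿inverseˡ (f i)) , (λ f i → -‿inverseʳ (f i))
            ; ⁻¹-cong = λ h i → -‿cong (h i) }
          ; comm = λ f g i → +-comm (f i) (g i) }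
        ; *-cong = λ h k → conv-cong h k
        ; *-assoc = conv-assoc
        ; *-identity = conv-identityˡ , (λ f N → trans (conv-comm f e N) (conv-identityˡ f N))
        ; distrib = conv-distribˡ , (λ f g h N → trans (conv-comm (λ i → g i + h i) f N)
                      (trans (conv-distribˡ f g h N) (+-cong (conv-comm f g N) (conv-comm f h N)))) }
      ; *-comm = conv-comm } }

  conv-divide : ∀ l c b D → (∀ N → conv l c N ≈ b N) → (∀ N → conv c D N ≈ e N) → ∀ N → l N ≈ conv b D N
  conv-divide l c b D lc≈b cD≈1 N = sym (begin
    conv b D N          ≈⟨ conv-cong {g = D} (λ i → sym (lc≈b i)) (λ _ → refl) N ⟩
    conv (conv l c) D N ≈⟨ conv-assoc l c D N ⟩
    conv l (conv c D) N ≈⟨ conv-cong {f = l} (λ _ → refl) cD≈1 N ⟩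
    conv l e N          ≈⟨ conv-comm l e N ⟩
    conv e l N          ≈⟨ conv-identityˡ l N ⟩
    l N                 ∎)

module SparseSeries {c ℓ} (R : CommutativeRing c ℓ) where
  open CommutativeRing R
  open Convolution R
  open import Relation.Binary.Reasoning.Setoid setoid
  open import Algebra.Solver.Ring.NaturalCoefficients.Default commutativeSemiring

  sp : (ℕ → ℕ) → (ℕ → Carrier) → ℕ → Carrier
  sp e a N = Σ (suc N) (λ n → δ (e n) N * a n)

  sp-cong : ∀ e {a b} → (∀ n → a n ≈ b n) → ∀ N → sp e a N ≈ sp e b N
  sp-cong e h N = Σ-cong′ (suc N) (λ n → *-congˡ {δ (e n) N} (h n))

  sp-widen : ∀ e a T N → (∀ n → n ≤ e n) → N < T → sp e a N ≈ Σ T (λ n → δ (e n) N * a n)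
  sp-widen e a T N n≤e N<T = begin
    sp e a N                          ≈⟨ sym (Σ-extend (suc N) (T ∸ suc N) F vanish) ⟩
    Σ (suc N +ℕ (T ∸ suc N)) F        ≡⟨ P.cong (λ x → Σ x F) (ℕP.m+[n∸m]≡n N<T) ⟩
    Σ T F                             ∎
    where
    F : ℕ → Carrier
    F n = δ (e n) N * a n
    vanish : ∀ n → F (suc N +ℕ n) ≈ 0#
    vanish n = trans (reflexive (P.cong (λ b → (if b then 1# else 0#) * a (suc N +ℕ n))
                       (≡ᵇ-> (e (suc N +ℕ n)) N (ℕP.<-≤-trans (s≤s (ℕP.m≤m+n N n)) (n≤e (suc N +ℕ n))))))
                     (zeroˡ (a (suc N +ℕ n)))

  -- x^x′ · x^y′ = x^(x′ + y′), on the level of coefficients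
  conv-δ : ∀ N x y (c : Carrier) → Σ (suc N) (λ i → δ x i * (δ y (N ∸ i) * c)) ≈ δ (x +ℕ y) N * c
  conv-δ N x y c with x ℕP.≤? N
  ... | yes x≤N = trans (Σ-δ-select (suc N) x (λ i → δ y (N ∸ i) * c))
                    (trans (below-true (suc N) x (δ y (N ∸ x) * c) (s≤s x≤N))
                      (reflexive (P.cong (λ b → (if b then 1# else 0#) * c) (P.sym (≡ᵇ-shift x y N x≤N)))))
  ... | no  x≰N = trans (Σ-δ-select (suc N) x (λ i → δ y (N ∸ i) * c))
                    (trans (below-false (suc N) x (δ y (N ∸ x) * c) (ℕP.≰⇒> x≰N))
                      (sym (trans (reflexive (P.cong (λ b → (if b then 1# else 0#) * c)
                                   (≡ᵇ-> (x +ℕ y) N (ℕP.<-≤-trans (ℕP.≰⇒> x≰N) (ℕP.m≤m+n x y)))))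
                                  (zeroˡ c))))

  conv-sp : ∀ e₁ e₂ a b N → (∀ n → n ≤ e₁ n) → (∀ m → m ≤ e₂ m) →
    conv (sp e₁ a) (sp e₂ b) N ≈ Σ (suc N) (λ n → Σ (suc N) (λ m → δ (e₁ n +ℕ e₂ m) N * (a n * b m)))
  conv-sp e₁ e₂ a b N n≤e₁ m≤e₂ = begin
    Σ T (λ i → sp e₁ a i * sp e₂ b (N ∸ i))
      ≈⟨ Σ-cong T (λ i i<T → *-cong (sp-widen e₁ a T i n≤e₁ i<T) (sp-widen e₂ b T (N ∸ i) m≤e₂ (s≤s (ℕP.m∸n≤m N i)))) ⟩
    Σ T (λ i → Σ T (λ n → δ (e₁ n) i * a n) * Σ T (λ m → δ (e₂ m) (N ∸ i) * b m))
      ≈⟨ Σ-cong′ T (λ i → trans (Σ-*ʳ T (Σ T (λ m → δ (e₂ m) (N ∸ i) * b m)) (λ n → δ (e₁ n) i * a n))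
           (Σ-cong′ T (λ n → trans (Σ-*ˡ T (δ (e₁ n) i * a n) (λ m → δ (e₂ m) (N ∸ i) * b m))
              (Σ-cong′ T (λ m → rearrange (δ (e₁ n) i) (a n) (δ (e₂ m) (N ∸ i)) (b m)))))) ⟩
    Σ T (λ i → Σ T (λ n → Σ T (λ m → K i n m)))
      ≈⟨ Σ-swap T T (λ i n → Σ T (λ m → K i n m)) ⟩
    Σ T (λ n → Σ T (λ i → Σ T (λ m → K i n m)))
      ≈⟨ Σ-cong′ T (λ n → Σ-swap T T (λ i m → K i n m)) ⟩
    Σ T (λ n → Σ T (λ m → Σ T (λ i → K i n m)))
      ≈⟨ Σ-cong′ T (λ n → Σ-cong′ T (λ m → conv-δ N (e₁ n) (e₂ m) (a n * b m))) ⟩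
    Σ T (λ n → Σ T (λ m → δ (e₁ n +ℕ e₂ m) N * (a n * b m))) ∎
    where
    T = suc N
    K : ℕ → ℕ → ℕ → Carrier
    K i n m = δ (e₁ n) i * (δ (e₂ m) (N ∸ i) * (a n * b m))
    rearrange : ∀ (d₁ x d₂ y : Carrier) → (d₁ * x) * (d₂ * y) ≈ d₁ * (d₂ * (x * y))
    rearrange = solve 4 (λ d₁ x d₂ y → (d₁ :* x) :* (d₂ :* y) := d₁ :* (d₂ :* (x :* y))) refl

  Σ²-regroup : ∀ N (W : ℕ → Carrier) (F : ℕ → ℕ → Carrier) → (∀ M → N < M → W M ≈ 0#) →
    Σ (suc N) (λ n → Σ (suc N) (λ m → W (n +ℕ m) * F n m)) ≈ Σ (suc N) (λ M → W M * Σ (suc M) (λ n → F n (M ∸ n)))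
  Σ²-regroup N W F W-vanish = begin
    Σ T (λ n → Σ T (λ m → W (n +ℕ m) * F n m))
      ≈⟨ Σ-cong′ T (λ n → Σ-cong′ T (λ m → trans (*-congʳ (W-as-Σ (n +ℕ m)))
           (trans (Σ-*ʳ T (F n m) (λ M → δ (n +ℕ m) M * W M))
             (Σ-cong′ T (λ M → rearrange (δ (n +ℕ m) M) (W M) (F n m)))))) ⟩
    Σ T (λ n → Σ T (λ m → Σ T (λ M → L n m M)))
      ≈⟨ Σ-cong′ T (λ n → Σ-swap T T (λ m M → L n m M)) ⟩
    Σ T (λ n → Σ T (λ M → Σ T (λ m → L n m M)))
      ≈⟨ Σ-swap T T (λ n M → Σ T (λ m → L n m M)) ⟩
    Σ T (λ M → Σ T (λ n → Σ T (λ m → L n m M)))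
      ≈⟨ Σ-cong′ T (λ M → trans (Σ-cong′ T (λ n → sym (Σ-*ˡ T (W M) (λ m → δ (n +ℕ m) M * F n m))))
           (sym (Σ-*ˡ T (W M) (λ n → Σ T (λ m → δ (n +ℕ m) M * F n m))))) ⟩
    Σ T (λ M → W M * Σ T (λ n → Σ T (λ m → δ (n +ℕ m) M * F n m)))
      ≈⟨ Σ-cong T (λ M M<T → *-congˡ {W M} (Σ²-antidiagonal T M F M<T)) ⟩
    Σ T (λ M → W M * Σ (suc M) (λ n → F n (M ∸ n))) ∎
    where
    T = suc N
    L : ℕ → ℕ → ℕ → Carrier
    L n m M = W M * (δ (n +ℕ m) M * F n m)
    rearrange : ∀ (d w f : Carrier) → (d * w) * f ≈ w * (d * f)
    rearrange = solve 3 (λ d w f → (d :* w) :* f := w :* (d :* f)) refl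
    W-as-Σ : ∀ x → W x ≈ Σ T (λ M → δ x M * W M)
    W-as-Σ x with x ℕP.<? T
    ... | yes x<T = sym (trans (Σ-δ-select T x W) (below-true T x (W x) x<T))
    ... | no  x≮T = trans (W-vanish x (ℕP.≮⇒≥ x≮T))
                      (sym (trans (Σ-δ-select T x W) (below-false T x (W x) (ℕP.≮⇒≥ x≮T))))

  conv-progressions : ∀ r k a b → 1 ≤ r → ∀ N →
    conv (sp (λ n → r *ℕ n +ℕ k) a) (sp (r *ℕ_) b) N ≈ sp (λ n → r *ℕ n +ℕ k) (conv a b) N
  conv-progressions r k a b r≥1 N = begin
    conv (sp e₁ a) (sp (r *ℕ_) b) N
      ≈⟨ conv-sp e₁ (r *ℕ_) a b N n≤e₁ n≤rn ⟩
    Σ (suc N) (λ n → Σ (suc N) (λ m → δ (e₁ n +ℕ r *ℕ m) N * (a n * b m)))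
      ≈⟨ Σ-cong′ (suc N) (λ n → Σ-cong′ (suc N) (λ m → reflexive (P.cong (λ x → δ x N * (a n * b m)) (exponents n m)))) ⟩
    Σ (suc N) (λ n → Σ (suc N) (λ m → W (n +ℕ m) * (a n * b m)))
      ≈⟨ Σ²-regroup N W (λ n m → a n * b m) W-vanish ⟩
    Σ (suc N) (λ M → W M * conv a b M) ∎
    where
    e₁ : ℕ → ℕ
    e₁ n = r *ℕ n +ℕ k
    W : ℕ → Carrier
    W M = δ (e₁ M) N
    n≤rn : ∀ n → n ≤ r *ℕ n
    n≤rn n = P.subst (_≤ r *ℕ n) (ℕP.*-identityˡ n) (ℕP.*-monoˡ-≤ n r≥1)
    n≤e₁ : ∀ n → n ≤ e₁ n
    n≤e₁ n = ℕP.≤-trans (n≤rn n) (ℕP.m≤m+n (r *ℕ n) k)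
    exponents : ∀ n m → e₁ n +ℕ r *ℕ m ≡ e₁ (n +ℕ m)
    exponents n m = P.trans (ℕP.+-assoc (r *ℕ n) k (r *ℕ m))
      (P.trans (P.cong (r *ℕ n +ℕ_) (ℕP.+-comm k (r *ℕ m)))
        (P.trans (P.sym (ℕP.+-assoc (r *ℕ n) (r *ℕ m) k)) (P.cong (_+ℕ k) (P.sym (ℕP.*-distribˡ-+ r n m)))))
    W-vanish : ∀ M → N < M → W M ≈ 0#
    W-vanish M N<M = reflexive (P.cong (λ b → if b then 1# else 0#) (≡ᵇ-> (e₁ M) N (ℕP.<-≤-trans N<M (n≤e₁ M))))

ℤ-ring : CommutativeRing 0ℓ 0ℓ
ℤ-ring = ℤP.+-*-commutativeRing

module ℤ-Series = Convolution ℤ-ring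

ℤ[[q]] : CommutativeRing 0ℓ 0ℓ
ℤ[[q]] = ℤ-Series.seriesRing

⟦_⟧ : Poly → ℕ → ℤ
⟦ []    ⟧ i       = + 0
⟦ x ∷ p ⟧ zero    = x
⟦ x ∷ p ⟧ (suc i) = ⟦ p ⟧ i

⟦padd⟧ : ∀ p p′ i → ⟦ padd p p′ ⟧ i ≡ ⟦ p ⟧ i ℤ.+ ⟦ p′ ⟧ i
⟦padd⟧ []      p′       i       = P.sym (ℤP.+-identityˡ _)
⟦padd⟧ (x ∷ p) []       i       = P.sym (ℤP.+-identityʳ _)
⟦padd⟧ (x ∷ p) (y ∷ p′) zero    = P.refl
⟦padd⟧ (x ∷ p) (y ∷ p′) (suc i) = ⟦padd⟧ p p′ i

⟦pneg⟧ : ∀ p i → ⟦ pneg p ⟧ i ≡ ℤ.- ⟦ p ⟧ i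
⟦pneg⟧ []      i       = P.refl
⟦pneg⟧ (x ∷ p) zero    = P.refl
⟦pneg⟧ (x ∷ p) (suc i) = ⟦pneg⟧ p i

⟦scale⟧ : ∀ x p i → ⟦ map (x ℤ.*_) p ⟧ i ≡ x ℤ.* ⟦ p ⟧ i
⟦scale⟧ x []      i       = P.sym (ℤP.*-zeroʳ x)
⟦scale⟧ x (y ∷ p) zero    = P.refl
⟦scale⟧ x (y ∷ p) (suc i) = ⟦scale⟧ x p i

-- Polynomial multiplication is the Cauchy product of coefficient sequences:
-- by definition of `conv`, the product of x ∷ p with p′ has coefficients
-- x·p′₀ and x·p′ᵢ₊₁ + (p·p′)ᵢ.
⟦pmul⟧ : ∀ p p′ N → ⟦ pmul p p′ ⟧ N ≡ ℤ-Series.conv ⟦ p ⟧ ⟦ p′ ⟧ N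
⟦pmul⟧ []      p′ N       = P.sym (ℤ-Series.Σ-0 (suc N) (λ _ _ → P.refl))
⟦pmul⟧ (x ∷ p) p′ zero    = P.trans (⟦padd⟧ (map (x ℤ.*_) p′) (+ 0 ∷ pmul p p′) 0)
                                    (P.cong (ℤ._+ + 0) (⟦scale⟧ x p′ 0))
⟦pmul⟧ (x ∷ p) p′ (suc N) = P.trans (⟦padd⟧ (map (x ℤ.*_) p′) (+ 0 ∷ pmul p p′) (suc N))
                                    (P.cong₂ ℤ._+_ (⟦scale⟧ x p′ (suc N)) (⟦pmul⟧ p p′ N))

⟦mono⟧ : ∀ m i → ⟦ mono m ⟧ i ≡ ℤ-Series.δ i m
⟦mono⟧ zero    zero    = P.refl
⟦mono⟧ zero    (suc i) = P.refl
⟦mono⟧ (suc m) zero    = P.refl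
⟦mono⟧ (suc m) (suc i) = ⟦mono⟧ m i

⟦⟧≡0⇒IsZeroPoly : ∀ p → (∀ i → ⟦ p ⟧ i ≡ + 0) → IsZeroPoly p
⟦⟧≡0⇒IsZeroPoly []      h = tt
⟦⟧≡0⇒IsZeroPoly (x ∷ p) h = h zero , ⟦⟧≡0⇒IsZeroPoly p (λ i → h (suc i))

module X = Convolution ℤ[[q]]
module XSparse = SparseSeries ℤ[[q]]

module InPowerSeries where
  open CommutativeRing ℤ[[q]] public
  open import Relation.Binary.Reasoning.Setoid setoid public
  open import Algebra.Properties.Ring ring public using (-‿distribˡ-*)
  open import Algebra.Solver.Ring.NaturalCoefficients.Default commutativeSemiring public
    using (solve; con; _:+_; _:*_; _:=_)
  module ℤS = ℤ-Series
  open X using (Σ; sign; conv)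
  open XSparse using (sp)

  -- Congruences with the fixed operand explicit: equality in ℤ[[q]] is
  -- pointwise, so Agda cannot infer that operand.
  infixl 7 _*≈_ _≈*_
  infixl 6 _+≈_
  _*≈_ : ∀ x {y z} → y ≈ z → x * y ≈ x * z
  x *≈ y≈z = *-cong (refl {x}) y≈z

  _≈*_ : ∀ {y z} → y ≈ z → ∀ x → y * x ≈ z * x
  y≈z ≈* x = *-cong y≈z (refl {x})

  _+≈_ : ∀ x {y z} → y ≈ z → x + y ≈ x + z
  x +≈ y≈z = +-cong (refl {x}) y≈z

  q^ : ℕ → Carrier
  q^ m i = ℤS.δ i m

  q^-+ : ∀ a b → q^ (a +ℕ b) ≈ q^ a * q^ b
  q^-+ a b N with a ℕP.≤? N
  ... | yes a≤N = P.sym (P.trans (ℤS.Σ-δ (suc N) a (λ i → q^ b (N ∸ i)) (s≤s a≤N))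
                    (P.cong (λ c → if c then + 1 else + 0)
                       (P.trans (≡ᵇ-sym (N ∸ a) b) (P.trans (P.sym (≡ᵇ-shift a b N a≤N)) (≡ᵇ-sym (a +ℕ b) N)))))
  ... | no  a≰N = P.sym (P.trans (ℤS.Σ-δ-out (suc N) a (λ i → q^ b (N ∸ i)) (ℕP.≰⇒> a≰N))
                    (P.cong (λ c → if c then + 1 else + 0)
                       (P.sym (P.trans (≡ᵇ-sym N (a +ℕ b)) (≡ᵇ-> (a +ℕ b) N (ℕP.<-≤-trans (ℕP.≰⇒> a≰N) (ℕP.m≤m+n a b)))))))

  ⟦0∷⟧ : ∀ p → ⟦ + 0 ∷ p ⟧ ≈ q^ 1 * ⟦ p ⟧
  ⟦0∷⟧ p zero    = P.refl
  ⟦0∷⟧ p (suc i) = P.sym (P.trans (P.cong (ℤ._+ S) (ℤP.*-zeroˡ (⟦ p ⟧ (suc i))))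
                          (P.trans (ℤP.+-identityˡ S) (ℤS.Σ-δ (suc i) 0 (λ j → ⟦ p ⟧ (i ∸ j)) (s≤s z≤n))))
    where S = ℤS.Σ (suc i) (λ j → ℤS.δ j 0 ℤ.* ⟦ p ⟧ (i ∸ j))

  ⟦1∷⟧ : ∀ p → ⟦ + 1 ∷ p ⟧ ≈ 1# + q^ 1 * ⟦ p ⟧
  ⟦1∷⟧ p zero    = P.refl
  ⟦1∷⟧ p (suc i) = P.trans (⟦0∷⟧ p (suc i)) (P.sym (ℤP.+-identityˡ ((q^ 1 * ⟦ p ⟧) (suc i))))

  den⟦_⟧ : Poly → Carrier
  den⟦ t ⟧ = ⟦ + 1 ∷ t ⟧

  den-dmul : ∀ s t → den⟦ dmul s t ⟧ ≈ den⟦ s ⟧ * den⟦ t ⟧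
  den-dmul s t = begin
    den⟦ dmul s t ⟧
      ≈⟨ ⟦1∷⟧ (dmul s t) ⟩
    1# + q^ 1 * ⟦ padd s (padd t (+ 0 ∷ pmul s t)) ⟧
      ≈⟨ 1# +≈ (q^ 1 *≈ tail) ⟩
    1# + q^ 1 * (⟦ s ⟧ + (⟦ t ⟧ + q^ 1 * (⟦ s ⟧ * ⟦ t ⟧)))
      ≈⟨ solve 3 (λ X a b → con 1 :+ X :* (a :+ (b :+ X :* (a :* b))) := (con 1 :+ X :* a) :* (con 1 :+ X :* b))
               refl (q^ 1) ⟦ s ⟧ ⟦ t ⟧ ⟩
    (1# + q^ 1 * ⟦ s ⟧) * (1# + q^ 1 * ⟦ t ⟧)
      ≈⟨ *-cong (sym (⟦1∷⟧ s)) (sym (⟦1∷⟧ t)) ⟩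
    den⟦ s ⟧ * den⟦ t ⟧ ∎
    where
    tail : ⟦ padd s (padd t (+ 0 ∷ pmul s t)) ⟧ ≈ ⟦ s ⟧ + (⟦ t ⟧ + q^ 1 * (⟦ s ⟧ * ⟦ t ⟧))
    tail = begin
      ⟦ padd s (padd t (+ 0 ∷ pmul s t)) ⟧    ≈⟨ ⟦padd⟧ s (padd t (+ 0 ∷ pmul s t)) ⟩
      ⟦ s ⟧ + ⟦ padd t (+ 0 ∷ pmul s t) ⟧     ≈⟨ ⟦ s ⟧ +≈ ⟦padd⟧ t (+ 0 ∷ pmul s t) ⟩
      ⟦ s ⟧ + (⟦ t ⟧ + ⟦ + 0 ∷ pmul s t ⟧)    ≈⟨ ⟦ s ⟧ +≈ (⟦ t ⟧ +≈ ⟦0∷⟧ (pmul s t)) ⟩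
      ⟦ s ⟧ + (⟦ t ⟧ + q^ 1 * ⟦ pmul s t ⟧)   ≈⟨ ⟦ s ⟧ +≈ (⟦ t ⟧ +≈ (q^ 1 *≈ ⟦pmul⟧ s t)) ⟩
      ⟦ s ⟧ + (⟦ t ⟧ + q^ 1 * (⟦ s ⟧ * ⟦ t ⟧)) ∎

  IsUnit : Carrier → Set
  IsUnit d = d 0 ≡ + 1

  recip : Carrier → Carrier
  recip = ℤS.inverse

  recip-inverse : ∀ d → IsUnit d → d * recip d ≈ 1#
  recip-inverse d d-unit = ℤS.conv-inverse d (recip d) d-unit P.refl (ℤS.inverse-rec d)

  IsUnit-* : ∀ a b → IsUnit a → IsUnit b → IsUnit (a * b)
  IsUnit-* a b a-unit b-unit = P.trans (ℤP.+-identityʳ (a 0 ℤ.* b 0)) (P.cong₂ ℤ._*_ a-unit b-unit)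

  -- inverses are unique, so `recip` respects ≈ and products
  inverse-unique : ∀ x y z → x * y ≈ 1# → x * z ≈ 1# → y ≈ z
  inverse-unique x y z xy≈1 xz≈1 = begin
    y           ≈⟨ sym (*-identityʳ y) ⟩
    y * 1#      ≈⟨ y *≈ sym xz≈1 ⟩
    y * (x * z) ≈⟨ solve 3 (λ x y z → y :* (x :* z) := (x :* y) :* z) refl x y z ⟩
    (x * y) * z ≈⟨ xy≈1 ≈* z ⟩
    1# * z      ≈⟨ *-identityˡ z ⟩
    z           ∎

  recip-cong : ∀ a b → IsUnit a → IsUnit b → a ≈ b → recip a ≈ recip b
  recip-cong a b a-unit b-unit a≈b =
    inverse-unique a (recip a) (recip b) (recip-inverse a a-unit) (trans (a≈b ≈* recip b) (recip-inverse b b-unit))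

  recip-* : ∀ a b → IsUnit a → IsUnit b → recip (a * b) ≈ recip a * recip b
  recip-* a b a-unit b-unit = inverse-unique (a * b) (recip (a * b)) (recip a * recip b)
    (recip-inverse (a * b) (IsUnit-* a b a-unit b-unit)) (begin
    (a * b) * (recip a * recip b)
      ≈⟨ solve 4 (λ a b a′ b′ → (a :* b) :* (a′ :* b′) := (a :* a′) :* (b :* b′)) refl a b (recip a) (recip b) ⟩
    (a * recip a) * (b * recip b) ≈⟨ *-cong (recip-inverse a a-unit) (recip-inverse b b-unit) ⟩
    1# * 1#                       ≈⟨ *-identityˡ 1# ⟩
    1#                            ∎)

  recip-1 : recip 1# ≈ 1#
  recip-1 = inverse-unique 1# (recip 1#) 1# (recip-inverse 1# P.refl) (*-identityʳ 1#)

  cancelʳ : ∀ x y u → IsUnit u → x * u ≈ y * u → x ≈ y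
  cancelʳ x y u u-unit xu≈yu = begin
    x                  ≈⟨ sym (*-identityʳ x) ⟩
    x * 1#             ≈⟨ x *≈ sym (recip-inverse u u-unit) ⟩
    x * (u * recip u)  ≈⟨ sym (*-assoc x u (recip u)) ⟩
    (x * u) * recip u  ≈⟨ xu≈yu ≈* recip u ⟩
    (y * u) * recip u  ≈⟨ *-assoc y u (recip u) ⟩
    y * (u * recip u)  ≈⟨ y *≈ recip-inverse u u-unit ⟩
    y * 1#             ≈⟨ *-identityʳ y ⟩
    y                  ∎

  recip-dmul : ∀ s t → recip den⟦ dmul s t ⟧ ≈ recip den⟦ s ⟧ * recip den⟦ t ⟧
  recip-dmul s t = trans (recip-cong den⟦ dmul s t ⟧ (den⟦ s ⟧ * den⟦ t ⟧) P.refl (IsUnit-* den⟦ s ⟧ den⟦ t ⟧ P.refl P.refl) (den-dmul s t))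
                         (recip-* den⟦ s ⟧ den⟦ t ⟧ P.refl P.refl)

  ev : Frac → Carrier
  ev f = ⟦ num f ⟧ * recip den⟦ dtail f ⟧

  ev-+Q : ∀ f g → ev (f +Q g) ≈ ev f + ev g
  ev-+Q f g = begin
    ⟦ padd (pmul nf dg) (pmul ng df) ⟧ * recip den⟦ dmul (dtail f) (dtail g) ⟧
      ≈⟨ *-cong (trans (⟦padd⟧ (pmul nf dg) (pmul ng df)) (+-cong (⟦pmul⟧ nf dg) (⟦pmul⟧ ng df)))
                (recip-dmul (dtail f) (dtail g)) ⟩
    (⟦ nf ⟧ * ⟦ dg ⟧ + ⟦ ng ⟧ * ⟦ df ⟧) * (recip ⟦ df ⟧ * recip ⟦ dg ⟧)
      ≈⟨ solve 6 (λ a b c d e f → (a :* b :+ c :* d) :* (e :* f) := (a :* e) :* (b :* f) :+ (c :* f) :* (d :* e))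
               refl ⟦ nf ⟧ ⟦ dg ⟧ ⟦ ng ⟧ ⟦ df ⟧ (recip ⟦ df ⟧) (recip ⟦ dg ⟧) ⟩
    ev f * (⟦ dg ⟧ * recip ⟦ dg ⟧) + ev g * (⟦ df ⟧ * recip ⟦ df ⟧)
      ≈⟨ +-cong (ev f *≈ recip-inverse ⟦ dg ⟧ P.refl) (ev g *≈ recip-inverse ⟦ df ⟧ P.refl) ⟩
    ev f * 1# + ev g * 1#
      ≈⟨ +-cong (*-identityʳ (ev f)) (*-identityʳ (ev g)) ⟩
    ev f + ev g ∎
    where
    nf = num f
    ng = num g
    df = den f
    dg = den g

  ev-*Q : ∀ f g → ev (f *Q g) ≈ ev f * ev g
  ev-*Q f g = trans (*-cong (⟦pmul⟧ (num f) (num g)) (recip-dmul (dtail f) (dtail g)))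
    (solve 4 (λ a b c d → (a :* b) :* (c :* d) := (a :* c) :* (b :* d)) refl
           ⟦ num f ⟧ ⟦ num g ⟧ (recip ⟦ den f ⟧) (recip ⟦ den g ⟧))

  ev--Q : ∀ f → ev (-Q f) ≈ - ev f
  ev--Q f = trans (⟦pneg⟧ (num f) ≈* recip ⟦ den f ⟧) (sym (-‿distribˡ-* ⟦ num f ⟧ (recip ⟦ den f ⟧)))

  ev-0Q : ev 0Q ≈ 0#
  ev-0Q = zeroˡ (recip ⟦ den 0Q ⟧)

  ⟦1⟧ : ⟦ + 1 ∷ [] ⟧ ≈ 1#
  ⟦1⟧ zero    = P.refl
  ⟦1⟧ (suc i) = P.refl

  ev-polyQ : ∀ p → ev (polyQ p) ≈ ⟦ p ⟧
  ev-polyQ p = trans (⟦ p ⟧ *≈ trans (recip-cong ⟦ + 1 ∷ [] ⟧ 1# P.refl P.refl ⟦1⟧) recip-1) (*-identityʳ ⟦ p ⟧)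

  ev-1Q : ev 1Q ≈ 1#
  ev-1Q = trans (ev-polyQ (+ 1 ∷ [])) ⟦1⟧

  ev-faithful : ∀ f g → ev f ≈ ev g → f ≈Q g
  ev-faithful f g ev-f≈ev-g = ⟦⟧≡0⇒IsZeroPoly _ (begin
    ⟦ padd (pmul (num f) (den g)) (pneg (pmul (num g) (den f))) ⟧
      ≈⟨ trans (⟦padd⟧ (pmul (num f) (den g)) (pneg (pmul (num g) (den f))))
               (+-cong (⟦pmul⟧ (num f) (den g)) (trans (⟦pneg⟧ (pmul (num g) (den f))) (-‿cong (⟦pmul⟧ (num g) (den f))))) ⟩
    nf * dg + - (ng * df) ≈⟨ +-congʳ cross ⟩
    ng * df + - (ng * df) ≈⟨ -‿inverseʳ (ng * df) ⟩
    0#                    ∎)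
    where
    nf = ⟦ num f ⟧
    ng = ⟦ num g ⟧
    df = ⟦ den f ⟧
    dg = ⟦ den g ⟧
    cross : nf * dg ≈ ng * df
    cross = begin
      nf * dg                         ≈⟨ sym (*-identityʳ (nf * dg)) ⟩
      (nf * dg) * 1#                  ≈⟨ (nf * dg) *≈ sym (recip-inverse df P.refl) ⟩
      (nf * dg) * (df * recip df)     ≈⟨ solve 4 (λ a b c d → (a :* b) :* (c :* d) := (a :* d) :* (c :* b)) refl nf dg df (recip df) ⟩
      ev f * (df * dg)                ≈⟨ ev-f≈ev-g ≈* (df * dg) ⟩
      ev g * (df * dg)                ≈⟨ solve 4 (λ a b c d → (a :* b) :* (c :* d) := (a :* c) :* (d :* b)) refl ng (recip dg) df dg ⟩
      (ng * df) * (dg * recip dg)     ≈⟨ (ng * df) *≈ recip-inverse dg P.refl ⟩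
      (ng * df) * 1#                  ≈⟨ *-identityʳ (ng * df) ⟩
      ng * df                         ∎

  fact : ℕ → Carrier
  fact m = den⟦ qfactTail m ⟧

  ev-divQFact : ∀ f m → ev (divQFact f m) ≈ ev f * recip (fact m)
  ev-divQFact f m = trans (⟦ num f ⟧ *≈ recip-dmul (dtail f) (qfactTail m))
                          (sym (*-assoc ⟦ num f ⟧ (recip ⟦ den f ⟧) (recip (fact m))))

  ev-signQ : ∀ n f → ev (signQ n f) ≈ sign n * ev f
  ev-signQ zero    f = sym (*-identityˡ (ev f))
  ev-signQ (suc n) f = trans (ev--Q (signQ n f)) (trans (-‿cong (ev-signQ n f)) (-‿distribˡ-* (sign n) (ev f)))

  ev-sumQ : ∀ n (g : ℕ → Frac) (h : ℕ → ℕ) → ev (sumQ (map g (applyUpTo h n))) ≈ Σ n (λ i → ev (g (h i)))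
  ev-sumQ zero    g h = ev-0Q
  ev-sumQ (suc n) g h = trans (ev-+Q (g (h 0)) (sumQ (map g (applyUpTo (λ i → h (suc i)) n))))
                              (ev (g (h 0)) +≈ ev-sumQ n g (λ i → h (suc i)))

  ev-zipSum : ∀ n (f : ℕ → Frac) (h : ℕ → ℕ) (g : ℕ → Frac) →
    ev (zipSum (map f (applyUpTo h n)) (applyUpTo g n)) ≈ Σ n (λ j → ev (f (h j)) * ev (g j))
  ev-zipSum zero    f h g = ev-0Q
  ev-zipSum (suc n) f h g =
    trans (ev-+Q (f (h 0) *Q g 0) (zipSum (map f (applyUpTo (λ j → h (suc j)) n)) (applyUpTo (λ j → g (suc j)) n)))
          (+-cong (ev-*Q (f (h 0)) (g 0)) (ev-zipSum n f (λ j → h (suc j)) (λ j → g (suc j))))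

  ev-if : ∀ b x → ev (if b then x else 0Q) ≈ (if b then 1# else 0#) * ev x
  ev-if true  x = sym (*-identityˡ (ev x))
  ev-if false x = trans ev-0Q (sym (zeroˡ (ev x)))

  ev-sparse : ∀ e c N → ev (sparse e c N) ≈ sp e (λ n → ev (c n)) N
  ev-sparse e c N = trans (ev-sumQ (suc N) (λ n → if e n ≡ᵇ N then c n else 0Q) (λ i → i))
                          (X.Σ-cong′ (suc N) (λ n → ev-if (e n ≡ᵇ N) (c n)))

  ev-⊛ : ∀ A B N → ev ((A ⊛ B) N) ≈ conv (λ i → ev (A i)) (λ i → ev (B i)) N
  ev-⊛ A B N = trans (ev-sumQ (suc N) (λ i → A i *Q B (N ∸ i)) (λ i → i))
                     (X.Σ-cong′ (suc N) (λ i → ev-*Q (A i) (B (N ∸ i))))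

  invRev-tabulate : ∀ C N → invRev C N ≡ applyUpTo (λ j → inv1 C (N ∸ j)) (suc N)
  invRev-tabulate C zero    = P.refl
  invRev-tabulate C (suc N) = P.cong (inv1 C (suc N) ∷_) (invRev-tabulate C N)

  ev-inv1 : ∀ C N → ev (inv1 C (suc N)) ≈ - Σ (suc N) (λ j → ev (C (suc j)) * ev (inv1 C (N ∸ j)))
  ev-inv1 C N = trans (ev--Q (zipSum (map (λ j → C (suc j)) (upTo (suc N))) (invRev C N)))
    (-‿cong (trans (reflexive (P.cong (λ l → ev (zipSum (map (λ j → C (suc j)) (upTo (suc N))) l))
                                             (invRev-tabulate C N)))
                   (ev-zipSum (suc N) (λ j → C (suc j)) (λ i → i) (λ j → inv1 C (N ∸ j)))))

-- Descent patterns: words over {𝐚, 𝐛, ∗}, with the wildcard ∗ = nothing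
-- matching either letter.

Pattern : Set
Pattern = List (Maybe Letter)

accepts : Letter → Maybe Letter → Bool
accepts l nothing  = true
accepts l (just m) = eqLetter l m

matches : Word → Pattern → Bool
matches []      []      = true
matches (l ∷ d) (c ∷ p) = accepts l c ∧ matches d p
matches []      (_ ∷ _) = false
matches (_ ∷ _) []      = false

eqWord-matches : ∀ d u → eqWord d u ≡ matches d (map just u)
eqWord-matches []      []      = P.refl
eqWord-matches []      (_ ∷ _) = P.refl
eqWord-matches (_ ∷ _) []      = P.refl
eqWord-matches (x ∷ d) (y ∷ u) = P.cong (eqLetter x y ∧_) (eqWord-matches d u)

insertAt : ℕ → ℕ → List ℕ → List ℕ
insertAt zero    x τ       = x ∷ τ
insertAt (suc i) x []      = x ∷ []
insertAt (suc i) x (y ∷ τ) = y ∷ insertAt i x τ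

-- Inserting a new maximum at position i creates the letters 𝐚 (before it)
-- and 𝐛 (after it), and merges the two pattern positions around it into one
-- unconstrained position.  `peak i p` returns whether p accepts the created
-- letters, and the pattern that the remaining permutation has to match.
acceptsA acceptsB : Maybe Letter → Bool
acceptsA c = accepts 𝐚 c
acceptsB c = accepts 𝐛 c

peak : ℕ → Pattern → Bool × Pattern
peak zero          []          = true , []
peak zero          (c ∷ p)     = acceptsB c , p
peak (suc zero)    []          = false , []
peak (suc zero)    (c ∷ [])    = acceptsA c , []
peak (suc zero)    (c ∷ d ∷ p) = acceptsA c ∧ acceptsB d , nothing ∷ p
peak (suc (suc i)) []          = false , []
peak (suc (suc i)) (c ∷ p)     = proj₁ (peak (suc i) p) , c ∷ proj₂ (peak (suc i) p)

peakOK : ℕ → Pattern → Bool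
peakOK i p = proj₁ (peak i p)

contract : ℕ → Pattern → Pattern
contract i p = proj₂ (peak i p)

<⇒<ᵇ-false : ∀ {x y} → y < x → (x <ᵇ y) ≡ false
<⇒<ᵇ-false {x} {y} y<x = <ᵇ-false x y (ℕP.<⇒≤ y<x)

∧-swap : ∀ a b c → a ∧ (b ∧ c) ≡ b ∧ (a ∧ c)
∧-swap true  b c = P.refl
∧-swap false b c = P.sym (BoolP.∧-zeroʳ b)

matches-insertAt : ∀ i x τ p → All (_< x) τ → length p ≡ length τ → i ≤ length τ →
  matches (desWord (insertAt i x τ)) p ≡ peakOK i p ∧ matches (desWord τ) (contract i p)
matches-insertAt zero x [] [] _ _ _ = P.refl
matches-insertAt zero x (y ∷ τ) (c ∷ p) (y<x ∷ _) _ _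
  rewrite <⇒<ᵇ-false y<x = P.refl
matches-insertAt (suc zero) x (y ∷ []) (c ∷ []) (y<x ∷ _) _ _
  rewrite <ᵇ-true y x y<x = P.refl
matches-insertAt (suc zero) x (y ∷ z ∷ τ) (c ∷ d ∷ p) (y<x ∷ z<x ∷ _) _ _
  rewrite <ᵇ-true y x y<x | <⇒<ᵇ-false z<x = P.sym (BoolP.∧-assoc (acceptsA c) (acceptsB d) _)
matches-insertAt (suc (suc i)) x (y ∷ z ∷ τ) (c ∷ p) (_ ∷ rest) len (s≤s i≤) =
  P.trans (P.cong (accepts (if y <ᵇ z then 𝐚 else 𝐛) c ∧_)
                  (matches-insertAt (suc i) x (z ∷ τ) p rest (ℕP.suc-injective len) i≤))
          (∧-swap (accepts (if y <ᵇ z then 𝐚 else 𝐛) c) (peakOK (suc i) p) _)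
matches-insertAt zero          x []          (_ ∷ _)     _ () _
matches-insertAt zero          x (_ ∷ _)     []          _ () _
matches-insertAt (suc i)       x []          p           _ _  ()
matches-insertAt (suc zero)    x (y ∷ [])    []          _ () _
matches-insertAt (suc zero)    x (y ∷ [])    (c ∷ _ ∷ _) _ () _
matches-insertAt (suc zero)    x (y ∷ _ ∷ _) []          _ () _
matches-insertAt (suc zero)    x (y ∷ _ ∷ _) (_ ∷ [])    _ () _
matches-insertAt (suc (suc i)) x (y ∷ [])    p           _ _  (s≤s ())
matches-insertAt (suc (suc i)) x (y ∷ z ∷ τ) []          _ () _

-- A new maximum inserted at position i lies before length τ ∸ i smaller entries.
countLess-all : ∀ x τ → All (_< x) τ → countLess x τ ≡ length τ
countLess-all x []      _         = P.refl
countLess-all x (y ∷ τ) (y<x ∷ h) rewrite <ᵇ-true y x y<x = P.cong suc (countLess-all x τ h)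

countLess-insertAt : ∀ i x y τ → y < x → countLess y (insertAt i x τ) ≡ countLess y τ
countLess-insertAt zero    x y τ       y<x rewrite <⇒<ᵇ-false y<x = P.refl
countLess-insertAt (suc i) x y []      y<x rewrite <⇒<ᵇ-false y<x = P.refl
countLess-insertAt (suc i) x y (z ∷ τ) y<x =
  P.cong ((if z <ᵇ y then 1 else 0) +ℕ_) (countLess-insertAt i x y τ y<x)

inv-insertAt : ∀ i x τ → All (_< x) τ → i ≤ length τ → inv (insertAt i x τ) ≡ inv τ +ℕ (length τ ∸ i)
inv-insertAt zero x τ h _ =
  P.trans (P.cong (_+ℕ inv τ) (countLess-all x τ h)) (ℕP.+-comm (length τ) (inv τ))
inv-insertAt (suc i) x (y ∷ τ) (y<x ∷ h) (s≤s i≤) =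
  P.trans (P.cong₂ _+ℕ_ (countLess-insertAt i x y τ y<x) (inv-insertAt i x τ h i≤))
          (P.sym (ℕP.+-assoc (countLess y τ) (inv τ) (length τ ∸ i)))

Fits : ℕ → List ℕ → Set
Fits n σ = length σ ≡ n × All (_< suc n) σ

insertAll-fits : ∀ {Q : ℕ → Set} x τ → Q x → All Q τ →
  All (λ ρ → length ρ ≡ suc (length τ) × All Q ρ) (insertAll x τ)
insertAll-fits x []       qx []         = (P.refl , qx ∷ []) ∷ []
insertAll-fits x (y ∷ ys) qx (qy ∷ qys) = (P.refl , qx ∷ qy ∷ qys) ∷
  AllP.map⁺ (All.map (λ (ℓ , a) → P.cong suc ℓ , qy ∷ a) (insertAll-fits x ys qx qys))

perms-fit : ∀ n → All (Fits n) (perms n)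
perms-fit zero    = (P.refl , []) ∷ []
perms-fit (suc n) = AllP.concat⁺ (AllP.map⁺ (All.map (λ {τ} (ℓ , a) →
  All.map (λ (ℓ′ , a′) → P.trans ℓ′ (P.cong suc ℓ) , a′)
          (insertAll-fits (suc n) τ ℕP.≤-refl (All.map ℕP.m≤n⇒m≤1+n a))) (perms-fit n)))

-- `join m u l v` is the pattern u ∗ v for permutations of m + l values,
-- where u is a pattern for m values and v one for l values.
join : ℕ → Pattern → ℕ → Pattern → Pattern
join zero    u l       v = v
join (suc m) u zero    v = u
join (suc m) u (suc l) v = u ++ nothing ∷ v

contract-length : ∀ i p → i ≤ length p → length (contract i p) ≡ length p ∸ 1
contract-length zero          []          _       = P.refl
contract-length zero          (c ∷ p)     _       = P.refl
contract-length (suc zero)    (c ∷ [])    _       = P.refl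
contract-length (suc zero)    (c ∷ d ∷ p) _       = P.refl
contract-length (suc (suc i)) (c ∷ d ∷ p) (s≤s i≤) = P.cong suc (contract-length (suc i) (d ∷ p) i≤)
contract-length (suc i)       []          ()
contract-length (suc (suc i)) (c ∷ [])    (s≤s ())

peak-left : ∀ i u v → i ≤ length u →
  peak i (u ++ nothing ∷ v) ≡ (peakOK i u , join (length u) (contract i u) (suc (length v)) v)
peak-left zero          []          v _ = P.refl
peak-left zero          (c ∷ u)     v _ = P.refl
peak-left (suc zero)    (c ∷ [])    v _ = P.cong (_, nothing ∷ v) (BoolP.∧-identityʳ (acceptsA c))
peak-left (suc zero)    (c ∷ d ∷ u) v _ = P.refl
peak-left (suc (suc i)) (c ∷ d ∷ u) v (s≤s i≤) rewrite peak-left (suc i) (d ∷ u) v i≤ = P.refl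
peak-left (suc i)       []          v ()
peak-left (suc (suc i)) (c ∷ [])    v (s≤s ())

join-cons : ∀ c m u l v → c ∷ join (suc m) u l v ≡ join (suc (suc m)) (c ∷ u) l v
join-cons c m u zero    v = P.refl
join-cons c m u (suc l) v = P.refl

peak-right : ∀ j u v → j ≤ length v →
  peak (suc (length u) +ℕ j) (u ++ nothing ∷ v) ≡ (peakOK j v , join (suc (length u)) u (length v) (contract j v))
peak-right zero    []      []      _ = P.refl
peak-right zero    []      (d ∷ v) _ = P.refl
peak-right (suc j) []      (d ∷ v) _ = P.refl
peak-right (suc j) []      []      ()
peak-right j       (c ∷ u) v       j≤ rewrite peak-right j u v j≤ =
  P.cong (peakOK j v ,_) (join-cons c (length u) u (length v) (contract j v))

ascents : ℕ → Pattern
ascents j = replicate j (just 𝐚)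

peakOK-ascents : ∀ i j → i < j → peakOK i (ascents j) ≡ false
peakOK-ascents zero          (suc j)       _         = P.refl
peakOK-ascents (suc zero)    (suc (suc j)) _         = P.refl
peakOK-ascents (suc (suc i)) (suc j)       (s≤s i<j) = peakOK-ascents (suc i) j i<j
peakOK-ascents (suc zero)    (suc zero)    (s≤s ())

peak-ascents : ∀ j → peak j (ascents j) ≡ (true , ascents (j ∸ 1))
peak-ascents zero          = P.refl
peak-ascents (suc zero)    = P.refl
peak-ascents (suc (suc j)) rewrite peak-ascents (suc j) = P.refl

replicate-+ : ∀ {A : Set} a b (x : A) → replicate (a +ℕ b) x ≡ replicate a x ++ replicate b x
replicate-+ zero    b x = P.refl
replicate-+ (suc a) b x = P.cong (x ∷_) (replicate-+ a b x)

replicate-snoc : ∀ {A : Set} j (x : A) xs → replicate (suc j) x ++ xs ≡ replicate j x ++ x ∷ xs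
replicate-snoc zero    x xs = P.refl
replicate-snoc (suc j) x xs = P.cong (x ∷_) (replicate-snoc j x xs)

module QBinomials where
  open InPowerSeries

  -- The q-binomial coefficient [m + l choose m], by the q-Pascal recursion.
  qbinom : ℕ → ℕ → Carrier
  qbinom zero    l       = 1#
  qbinom (suc m) zero    = 1#
  qbinom (suc m) (suc l) = q^ (suc l) * qbinom m (suc l) + qbinom (suc m) l

  qint : ℕ → Carrier
  qint n = ⟦ replicate n (+ 1) ⟧

  fact-suc : ∀ n → fact (suc n) ≈ fact n * qint (suc n)
  fact-suc n = den-dmul (qfactTail n) (qintSucTail n)

  qint-+ : ∀ l m → qint (l +ℕ m) ≈ qint l + q^ l * qint m
  qint-+ zero    m = sym (trans (+-identityˡ _) (*-identityˡ _))
  qint-+ (suc l) m = begin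
    qint (suc (l +ℕ m))                    ≈⟨ ⟦1∷⟧ (replicate (l +ℕ m) (+ 1)) ⟩
    1# + q^ 1 * qint (l +ℕ m)              ≈⟨ 1# +≈ (q^ 1 *≈ qint-+ l m) ⟩
    1# + q^ 1 * (qint l + q^ l * qint m)   ≈⟨ solve 4 (λ X a Y b → con 1 :+ X :* (a :+ Y :* b) := (con 1 :+ X :* a) :+ (X :* Y) :* b)
                                                    refl (q^ 1) (qint l) (q^ l) (qint m) ⟩
    (1# + q^ 1 * qint l) + (q^ 1 * q^ l) * qint m
                                           ≈⟨ +-cong (sym (⟦1∷⟧ (replicate l (+ 1)))) (sym (q^-+ 1 l) ≈* qint m) ⟩
    qint (suc l) + q^ (suc l) * qint m     ∎

  qbinom-fact : ∀ m l → qbinom m l * (fact m * fact l) ≈ fact (m +ℕ l)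
  qbinom-fact zero    l       = trans (*-identityˡ _) (trans (⟦1⟧ ≈* fact l) (*-identityˡ _))
  qbinom-fact (suc m) zero    = trans (*-identityˡ _) (trans (fact (suc m) *≈ ⟦1⟧)
                                  (trans (*-identityʳ _) (reflexive (P.cong fact (P.sym (ℕP.+-identityʳ (suc m)))))))
  qbinom-fact (suc m) (suc l) = begin
    (X * B₁ + B₂) * (fact (suc m) * fact (suc l))
      ≈⟨ distribʳ (fact (suc m) * fact (suc l)) (X * B₁) B₂ ⟩
    (X * B₁) * (fact (suc m) * fact (suc l)) + B₂ * (fact (suc m) * fact (suc l))
      ≈⟨ +-cong ((X * B₁) *≈ (fact-suc m ≈* fact (suc l))) (B₂ *≈ (fact (suc m) *≈ fact-suc l)) ⟩
    (X * B₁) * ((fact m * Qm) * fact (suc l)) + B₂ * (fact (suc m) * (fact l * Ql))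
      ≈⟨ +-cong (solve 5 (λ X B Fm Q F → (X :* B) :* ((Fm :* Q) :* F) := (X :* Q) :* (B :* (Fm :* F)))
                         refl X B₁ (fact m) Qm (fact (suc l)))
                (solve 4 (λ B F Fl Q → B :* (F :* (Fl :* Q)) := Q :* (B :* (F :* Fl)))
                         refl B₂ (fact (suc m)) (fact l) Ql) ⟩
    (X * Qm) * (B₁ * (fact m * fact (suc l))) + Ql * (B₂ * (fact (suc m) * fact l))
      ≈⟨ +-cong ((X * Qm) *≈ qbinom-fact m (suc l))
                (Ql *≈ trans (qbinom-fact (suc m) l) (reflexive (P.cong fact (P.sym (ℕP.+-suc m l))))) ⟩
    (X * Qm) * K + Ql * K
      ≈⟨ solve 4 (λ X Qm Ql K → (X :* Qm) :* K :+ Ql :* K := K :* (Ql :+ X :* Qm)) refl X Qm Ql K ⟩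
    K * (Ql + X * Qm)
      ≈⟨ K *≈ sym (qint-+ (suc l) (suc m)) ⟩
    K * qint (suc l +ℕ suc m)
      ≈⟨ K *≈ reflexive (P.cong qint (ℕP.+-comm (suc l) (suc m))) ⟩
    K * qint (suc (m +ℕ suc l))
      ≈⟨ sym (fact-suc (m +ℕ suc l)) ⟩
    fact (suc m +ℕ suc l) ∎
    where
    X = q^ (suc l)
    B₁ = qbinom m (suc l)
    B₂ = qbinom (suc m) l
    Qm = qint (suc m)
    Ql = qint (suc l)
    K = fact (m +ℕ suc l)

  qbinom-ratio : ∀ b a → qbinom b a ≈ fact (b +ℕ a) * (recip (fact b) * recip (fact a))
  qbinom-ratio b a = begin
    qbinom b a                                                  ≈⟨ sym (*-identityʳ (qbinom b a)) ⟩
    qbinom b a * 1#                                             ≈⟨ qbinom b a *≈ sym one ⟩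
    qbinom b a * ((fact b * fact a) * (recip (fact b) * recip (fact a)))
                                                                ≈⟨ sym (*-assoc (qbinom b a) (fact b * fact a) _) ⟩
    (qbinom b a * (fact b * fact a)) * (recip (fact b) * recip (fact a))
                                                                ≈⟨ qbinom-fact b a ≈* (recip (fact b) * recip (fact a)) ⟩
    fact (b +ℕ a) * (recip (fact b) * recip (fact a))           ∎
    where
    one : (fact b * fact a) * (recip (fact b) * recip (fact a)) ≈ 1#
    one = trans (solve 4 (λ a b c d → (a :* b) :* (c :* d) := (a :* c) :* (b :* d)) refl
                         (fact b) (fact a) (recip (fact b)) (recip (fact a)))
                (trans (*-cong (recip-inverse (fact b) P.refl) (recip-inverse (fact a) P.refl)) (*-identityʳ 1#))

module Descents where
  open InPowerSeries
  open QBinomials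
  open X using (Σ; ΣL; when; when-cong; when-*ʳ; ΣL-cong; ΣL-cong-All; ΣL-+; ΣL-map; ΣL-concatMap; ΣL-Σ; ΣL-when;
                Σ-cong; Σ-cong′; Σ-0; Σ-*ʳ; Σ-split; Σ-last)

  βpat : ℕ → Pattern → Carrier
  βpat n p = ΣL (perms n) (λ σ → when (matches (desWord σ) p) (q^ (inv σ)))

  β : Word → Carrier
  β u = ⟦ betaPoly u ⟧

  β-βpat : ∀ u → β u ≈ βpat (suc (length u)) (map just u)
  β-βpat u = trans (go (perms (suc (length u))))
    (ΣL-cong (perms (suc (length u))) (λ σ → reflexive (P.cong (λ b → when b (q^ (inv σ))) (eqWord-matches (desWord σ) u))))
    where
    step : List ℕ → Poly → Poly
    step σ acc = if eqWord (desWord σ) u then padd (mono (inv σ)) acc else acc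
    go : ∀ L → ⟦ foldr step [] L ⟧ ≈ ΣL L (λ σ → when (eqWord (desWord σ) u) (q^ (inv σ)))
    go []      = refl
    go (σ ∷ L) with eqWord (desWord σ) u
    ... | true  = trans (⟦padd⟧ (mono (inv σ)) _) (+-cong (⟦mono⟧ (inv σ)) (go L))
    ... | false = trans (go L) (sym (+-identityˡ _))

  βpat-0 : βpat 0 [] ≈ 1#
  βpat-0 = +-identityʳ 1#

  ΣL-insertAll : ∀ x τ F → ΣL (insertAll x τ) F ≈ Σ (suc (length τ)) (λ i → F (insertAt i x τ))
  ΣL-insertAll x []       F = refl
  ΣL-insertAll x (y ∷ ys) F = F (x ∷ y ∷ ys) +≈ trans (ΣL-map (y ∷_) (insertAll x ys) F) (ΣL-insertAll x ys (λ ρ → F (y ∷ ρ)))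

  when-∧ : ∀ a b u v → when (a ∧ b) (q^ (u +ℕ v)) ≈ when a (q^ v * when b (q^ u))
  when-∧ true  true  u v = trans (reflexive (P.cong q^ (ℕP.+-comm u v))) (q^-+ v u)
  when-∧ true  false u v = sym (zeroʳ (q^ v))
  when-∧ false b     u v = refl

  -- Insertion of the maximum n + 1 into the permutations of n values.
  βpat-insertion : ∀ n p → length p ≡ n →
    βpat (suc n) p ≈ Σ (suc n) (λ i → when (peakOK i p) (q^ (n ∸ i) * βpat n (contract i p)))
  βpat-insertion n p len-p = begin
    βpat (suc n) p
      ≈⟨ ΣL-concatMap (insertAll (suc n)) (perms n) F ⟩
    ΣL (perms n) (λ τ → ΣL (insertAll (suc n) τ) F)
      ≈⟨ ΣL-cong-All (perms n) (perms-fit n) insert ⟩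
    ΣL (perms n) (λ τ → Σ (suc n) (G τ))
      ≈⟨ ΣL-Σ (perms n) (suc n) G ⟩
    Σ (suc n) (λ i → ΣL (perms n) (λ τ → G τ i))
      ≈⟨ Σ-cong′ (suc n) (λ i → ΣL-when (perms n) (peakOK i p) (q^ (n ∸ i))
                                   (λ τ → when (matches (desWord τ) (contract i p)) (q^ (inv τ)))) ⟩
    Σ (suc n) (λ i → when (peakOK i p) (q^ (n ∸ i) * βpat n (contract i p))) ∎
    where
    F : List ℕ → Carrier
    F σ = when (matches (desWord σ) p) (q^ (inv σ))
    G : List ℕ → ℕ → Carrier
    G τ i = when (peakOK i p) (q^ (n ∸ i) * when (matches (desWord τ) (contract i p)) (q^ (inv τ)))
    insert : ∀ τ → Fits n τ → ΣL (insertAll (suc n) τ) F ≈ Σ (suc n) (G τ)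
    insert τ (len-τ , τ<) with P.refl ← len-τ = trans (ΣL-insertAll (suc n) τ F) (Σ-cong (suc n) (λ i i<1+n →
      let i≤ = ℕP.≤-pred i<1+n in
      trans (reflexive (P.cong₂ (λ b m → when b (q^ m))
                                (matches-insertAt i (suc n) τ p τ< len-p i≤)
                                (inv-insertAt i (suc n) τ τ< i≤)))
            (when-∧ (peakOK i p) (matches (desWord τ) (contract i p)) (inv τ) (n ∸ i))))

  -- The permutations of m + l values matching u ∗ v: those matching u on
  -- the first m and v on the last l positions, interleaved in all ways.
  βpat-join : ∀ m l u v → length u ≡ m ∸ 1 → length v ≡ l ∸ 1 →
    βpat (m +ℕ l) (join m u l v) ≈ (βpat m u * βpat l v) * qbinom m l
  βpat-join zero    l       []      v _  _ = sym (trans (*-identityʳ _) (trans (βpat-0 ≈* βpat l v) (*-identityˡ _)))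
  βpat-join (suc m) zero    u       [] _  _ =
    trans (reflexive (P.cong (λ n → βpat n u) (ℕP.+-identityʳ (suc m))))
          (sym (trans (*-identityʳ _) (trans (βpat (suc m) u *≈ βpat-0) (*-identityʳ _))))
  βpat-join (suc m) (suc l) u v len-u len-v = begin
    βpat (suc n) p                                          ≈⟨ βpat-insertion n p len-p ⟩
    Σ (suc m +ℕ suc l) G                                    ≈⟨ Σ-split (suc m) (suc l) G ⟩
    Σ (suc m) G + Σ (suc l) (λ j → G (suc m +ℕ j))           ≈⟨ +-cong left right ⟩
    βu * (q^ (suc l) * (βv * qbinom m (suc l))) + βv * (βu * qbinom (suc m) l)
      ≈⟨ solve 5 (λ u v X B₁ B₂ → u :* (X :* (v :* B₁)) :+ v :* (u :* B₂) := (u :* v) :* (X :* B₁ :+ B₂))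
               refl βu βv (q^ (suc l)) (qbinom m (suc l)) (qbinom (suc m) l) ⟩
    (βu * βv) * qbinom (suc m) (suc l)                       ∎
    where
    n = m +ℕ suc l
    p = u ++ nothing ∷ v
    βu = βpat (suc m) u
    βv = βpat (suc l) v
    len-p : length p ≡ n
    len-p = P.trans (ListP.length-++ u) (P.cong₂ (λ a b → a +ℕ suc b) len-u len-v)
    G : ℕ → Carrier
    G i = when (peakOK i p) (q^ (n ∸ i) * βpat n (contract i p))
    -- a peak in the left part leaves the pattern (contract i u) ∗ v
    left : Σ (suc m) G ≈ βu * (q^ (suc l) * (βv * qbinom m (suc l)))
    left = begin
      Σ (suc m) G
        ≈⟨ Σ-cong (suc m) (λ i i<1+m → term i (ℕP.≤-pred i<1+m)) ⟩
      Σ (suc m) (λ i → when (peakOK i u) (q^ (m ∸ i) * βpat m (contract i u)) * W)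
        ≈⟨ sym (Σ-*ʳ (suc m) W (λ i → when (peakOK i u) (q^ (m ∸ i) * βpat m (contract i u)))) ⟩
      Σ (suc m) (λ i → when (peakOK i u) (q^ (m ∸ i) * βpat m (contract i u))) * W
        ≈⟨ sym (βpat-insertion m u len-u) ≈* W ⟩
      βu * W ∎
      where
      W = q^ (suc l) * (βv * qbinom m (suc l))
      term : ∀ i → i ≤ m → G i ≈ when (peakOK i u) (q^ (m ∸ i) * βpat m (contract i u)) * W
      term i i≤m = begin
        G i
          ≈⟨ reflexive (P.cong (λ pk → when (proj₁ pk) (q^ (n ∸ i) * βpat n (proj₂ pk))) peak-i) ⟩
        when (peakOK i u) (q^ (n ∸ i) * βpat n (join m (contract i u) (suc l) v))
          ≈⟨ when-cong (peakOK i u) (begin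
            q^ (n ∸ i) * βpat n (join m (contract i u) (suc l) v)
              ≈⟨ trans (reflexive (P.cong q^ (ℕP.+-∸-comm (suc l) i≤m))) (q^-+ (m ∸ i) (suc l)) ≈* βpat n (join m (contract i u) (suc l) v) ⟩
            (q^ (m ∸ i) * q^ (suc l)) * βpat (m +ℕ suc l) (join m (contract i u) (suc l) v)
              ≈⟨ (q^ (m ∸ i) * q^ (suc l)) *≈ βpat-join m (suc l) (contract i u) v
                   (P.trans (contract-length i u i≤|u|) (P.cong (_∸ 1) len-u)) len-v ⟩
            (q^ (m ∸ i) * q^ (suc l)) * ((βpat m (contract i u) * βv) * qbinom m (suc l))
              ≈⟨ solve 5 (λ a b c d e → (a :* b) :* ((c :* d) :* e) := (a :* c) :* (b :* (d :* e)))
                       refl (q^ (m ∸ i)) (q^ (suc l)) (βpat m (contract i u)) βv (qbinom m (suc l)) ⟩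
            (q^ (m ∸ i) * βpat m (contract i u)) * W ∎) ⟩
        when (peakOK i u) ((q^ (m ∸ i) * βpat m (contract i u)) * W)
          ≈⟨ sym (when-*ʳ (peakOK i u) (q^ (m ∸ i) * βpat m (contract i u)) W) ⟩
        when (peakOK i u) (q^ (m ∸ i) * βpat m (contract i u)) * W ∎
        where
        i≤|u| : i ≤ length u
        i≤|u| = P.subst (i ≤_) (P.sym len-u) i≤m
        peak-i : peak i p ≡ (peakOK i u , join m (contract i u) (suc l) v)
        peak-i = P.trans (peak-left i u v i≤|u|) (P.cong₂ (λ a b → (peakOK i u , join a (contract i u) (suc b) v)) len-u len-v)
    -- a peak in the right part leaves the pattern u ∗ (contract j v)
    right : Σ (suc l) (λ j → G (suc m +ℕ j)) ≈ βv * (βu * qbinom (suc m) l)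
    right = begin
      Σ (suc l) (λ j → G (suc m +ℕ j))
        ≈⟨ Σ-cong (suc l) (λ j j<1+l → term j (ℕP.≤-pred j<1+l)) ⟩
      Σ (suc l) (λ j → when (peakOK j v) (q^ (l ∸ j) * βpat l (contract j v)) * W)
        ≈⟨ sym (Σ-*ʳ (suc l) W (λ j → when (peakOK j v) (q^ (l ∸ j) * βpat l (contract j v)))) ⟩
      Σ (suc l) (λ j → when (peakOK j v) (q^ (l ∸ j) * βpat l (contract j v))) * W
        ≈⟨ sym (βpat-insertion l v len-v) ≈* W ⟩
      βv * W ∎
      where
      W = βu * qbinom (suc m) l
      term : ∀ j → j ≤ l → G (suc m +ℕ j) ≈ when (peakOK j v) (q^ (l ∸ j) * βpat l (contract j v)) * W
      term j j≤l = begin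
        G (suc m +ℕ j)
          ≈⟨ reflexive (P.cong (λ pk → when (proj₁ pk) (q^ (n ∸ (suc m +ℕ j)) * βpat n (proj₂ pk))) peak-j) ⟩
        when (peakOK j v) (q^ (n ∸ (suc m +ℕ j)) * βpat n (join (suc m) u l (contract j v)))
          ≈⟨ when-cong (peakOK j v) (begin
            q^ (n ∸ (suc m +ℕ j)) * βpat n (join (suc m) u l (contract j v))
              ≈⟨ reflexive (P.cong₂ (λ a b → q^ (a ∸ (suc m +ℕ j)) * βpat a (join (suc m) u l (contract j v)))
                                    (ℕP.+-suc m l) (ℕP.+-suc m l)) ⟩
            q^ (suc m +ℕ l ∸ (suc m +ℕ j)) * βpat (suc m +ℕ l) (join (suc m) u l (contract j v))
              ≈⟨ reflexive (P.cong q^ (ℕP.[m+n]∸[m+o]≡n∸o (suc m) l j)) ≈* βpat (suc m +ℕ l) (join (suc m) u l (contract j v)) ⟩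
            q^ (l ∸ j) * βpat (suc m +ℕ l) (join (suc m) u l (contract j v))
              ≈⟨ q^ (l ∸ j) *≈ βpat-join (suc m) l u (contract j v) len-u
                   (P.trans (contract-length j v j≤|v|) (P.cong (_∸ 1) len-v)) ⟩
            q^ (l ∸ j) * ((βu * βpat l (contract j v)) * qbinom (suc m) l)
              ≈⟨ solve 4 (λ a b c d → a :* ((b :* c) :* d) := (a :* c) :* (b :* d))
                       refl (q^ (l ∸ j)) βu (βpat l (contract j v)) (qbinom (suc m) l) ⟩
            (q^ (l ∸ j) * βpat l (contract j v)) * W ∎) ⟩
        when (peakOK j v) ((q^ (l ∸ j) * βpat l (contract j v)) * W)
          ≈⟨ sym (when-*ʳ (peakOK j v) (q^ (l ∸ j) * βpat l (contract j v)) W) ⟩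
        when (peakOK j v) (q^ (l ∸ j) * βpat l (contract j v)) * W ∎
        where
        j≤|v| : j ≤ length v
        j≤|v| = P.subst (j ≤_) (P.sym len-v) j≤l
        peak-j : peak (suc m +ℕ j) p ≡ (peakOK j v , join (suc m) u l (contract j v))
        peak-j = P.trans (P.cong (λ a → peak (suc a +ℕ j) p) (P.sym len-u))
                         (P.trans (peak-right j u v j≤|v|)
                                  (P.cong₂ (λ a b → (peakOK j v , join (suc a) u b (contract j v))) len-u len-v))

  -- A wildcard position matches 𝐚 or 𝐛, never both.
  when-wildcard : ∀ d p p′ x → when (matches d (p ++ nothing ∷ p′)) x
                              ≈ when (matches d (p ++ just 𝐚 ∷ p′)) x + when (matches d (p ++ just 𝐛 ∷ p′)) x
  when-wildcard []      []      p′ x = sym (+-identityˡ 0#)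
  when-wildcard []      (c ∷ p) p′ x = sym (+-identityˡ 0#)
  when-wildcard (𝐚 ∷ d) []      p′ x = sym (+-identityʳ _)
  when-wildcard (𝐛 ∷ d) []      p′ x = sym (+-identityˡ _)
  when-wildcard (l ∷ d) (c ∷ p) p′ x with accepts l c
  ... | true  = when-wildcard d p p′ x
  ... | false = sym (+-identityˡ 0#)

  βpat-wildcard : ∀ n p p′ → βpat n (p ++ nothing ∷ p′) ≈ βpat n (p ++ just 𝐚 ∷ p′) + βpat n (p ++ just 𝐛 ∷ p′)
  βpat-wildcard n p p′ = trans (ΣL-cong (perms n) (λ σ → when-wildcard (desWord σ) p p′ (q^ (inv σ))))
    (ΣL-+ (perms n) (λ σ → when (matches (desWord σ) (p ++ just 𝐚 ∷ p′)) (q^ (inv σ)))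
                    (λ σ → when (matches (desWord σ) (p ++ just 𝐛 ∷ p′)) (q^ (inv σ))))

  -- Only the identity permutation has descent word 𝐚^j.
  βpat-ascents : ∀ j → βpat (suc j) (ascents j) ≈ 1#
  βpat-ascents zero    = +-identityʳ 1#
  βpat-ascents (suc j) = begin
    βpat (suc (suc j)) (ascents (suc j)) ≈⟨ βpat-insertion (suc j) (ascents (suc j)) (ListP.length-replicate (suc j)) ⟩
    Σ (suc (suc j)) G                    ≈⟨ Σ-last (suc j) G ⟩
    Σ (suc j) G + G (suc j)              ≈⟨ +-cong (Σ-0 (suc j) no-peak) peak-at-end ⟩
    0# + 1#                              ≈⟨ +-identityˡ 1# ⟩
    1#                                   ∎
    where
    G : ℕ → Carrier
    G i = when (peakOK i (ascents (suc j))) (q^ (suc j ∸ i) * βpat (suc j) (contract i (ascents (suc j))))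
    no-peak : ∀ i → i < suc j → G i ≈ 0#
    no-peak i i<1+j = reflexive (P.cong (λ b → when b (q^ (suc j ∸ i) * βpat (suc j) (contract i (ascents (suc j)))))
                                        (peakOK-ascents i (suc j) i<1+j))
    peak-at-end : G (suc j) ≈ 1#
    peak-at-end with peak (suc j) (ascents (suc j)) | peak-ascents (suc j)
    ... | _ | P.refl = begin
      q^ (suc j ∸ suc j) * βpat (suc j) (ascents j) ≈⟨ reflexive (P.cong q^ (ℕP.n∸n≡0 j)) ≈* βpat (suc j) (ascents j) ⟩
      1# * βpat (suc j) (ascents j)                 ≈⟨ *-identityˡ _ ⟩
      βpat (suc j) (ascents j)                      ≈⟨ βpat-ascents j ⟩
      1#                                            ∎

  -- The key recurrence: β(𝐚^(j+1) W) + β(𝐚^j 𝐛 W) = β(W) · [j + 1 + |W| + 1 choose j + 1],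
  -- both sides counting the permutations with descent word 𝐚^j ∗ W.
  β-recurrence : ∀ j W → β (replicate (suc j) 𝐚 ++ W) + β (replicate j 𝐚 ++ 𝐛 ∷ W)
                        ≈ β W * qbinom (suc j) (suc (length W))
  β-recurrence j W = begin
    β (replicate (suc j) 𝐚 ++ W) + β (replicate j 𝐚 ++ 𝐛 ∷ W)
      ≈⟨ +-cong (trans (reflexive (P.cong β (replicate-snoc j 𝐚 W))) (as-pattern 𝐚))
                (as-pattern 𝐛) ⟩
    βpat n (Aⱼ ++ just 𝐚 ∷ map just W) + βpat n (Aⱼ ++ just 𝐛 ∷ map just W)
      ≈⟨ sym (βpat-wildcard n Aⱼ (map just W)) ⟩
    βpat n (Aⱼ ++ nothing ∷ map just W)
      ≈⟨ βpat-join (suc j) (suc (length W)) Aⱼ (map just W)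
                   (P.trans (ListP.length-map just (replicate j 𝐚)) (ListP.length-replicate j)) (ListP.length-map just W) ⟩
    (βpat (suc j) Aⱼ * βpat (suc (length W)) (map just W)) * qbinom (suc j) (suc (length W))
      ≈⟨ *-cong (trans (reflexive (P.cong (βpat (suc j)) (ListP.map-replicate just j 𝐚))) (βpat-ascents j))
                (sym (β-βpat W)) ≈* qbinom (suc j) (suc (length W)) ⟩
    (1# * β W) * qbinom (suc j) (suc (length W))
      ≈⟨ *-identityˡ (β W) ≈* qbinom (suc j) (suc (length W)) ⟩
    β W * qbinom (suc j) (suc (length W)) ∎
    where
    n = suc j +ℕ suc (length W)
    Aⱼ = map just (replicate j 𝐚)
    as-pattern : ∀ c → β (replicate j 𝐚 ++ c ∷ W) ≈ βpat n (Aⱼ ++ just c ∷ map just W)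
    as-pattern c = trans (β-βpat (replicate j 𝐚 ++ c ∷ W))
      (reflexive (P.cong₂ βpat (P.cong suc (P.trans (ListP.length-++ (replicate j 𝐚))
                                                    (P.cong (_+ℕ suc (length W)) (ListP.length-replicate j))))
                               (ListP.map-++ just (replicate j 𝐚) (c ∷ W))))

length-wpow : ∀ u n → length (wpow u n) ≡ n *ℕ length u
length-wpow u zero    = P.refl
length-wpow u (suc n) = P.trans (ListP.length-++ u) (P.cong (length u +ℕ_) (length-wpow u n))

module BlockWords (r k : ℕ) (r≥1 : 1 ≤ r) (k≥1 : 1 ≤ k) (w : Word) (len-w : length w ≡ k ∸ 1) where
  open P.≡-Reasoning

  block : Word
  block = replicate (r ∸ 1) 𝐚 ++ 𝐛 ∷ []

  W : ℕ → Word
  W n = wpow block n ++ w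

  length-block : length block ≡ r
  length-block = P.trans (ListP.length-++ (replicate (r ∸ 1) 𝐚))
                         (P.trans (P.cong (_+ℕ 1) (ListP.length-replicate (r ∸ 1))) (ℕP.m∸n+n≡m r≥1))

  length-W : ∀ n → suc (length (W n)) ≡ r *ℕ n +ℕ k
  length-W n = begin
    suc (length (wpow block n ++ w))          ≡⟨ P.cong suc (ListP.length-++ (wpow block n)) ⟩
    suc (length (wpow block n) +ℕ length w)   ≡⟨ P.cong₂ (λ a b → suc (a +ℕ b))
                                                   (P.trans (length-wpow block n) (P.cong (n *ℕ_) length-block)) len-w ⟩
    suc (n *ℕ r +ℕ (k ∸ 1))                   ≡⟨ P.sym (ℕP.+-suc (n *ℕ r) (k ∸ 1)) ⟩
    n *ℕ r +ℕ suc (k ∸ 1)                     ≡⟨ P.cong₂ _+ℕ_ (ℕP.*-comm n r) (ℕP.m+[n∸m]≡n k≥1) ⟩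
    r *ℕ n +ℕ k                               ∎

  peel-block : ∀ m n → replicate (r *ℕ suc m ∸ 1) 𝐚 ++ 𝐛 ∷ W n ≡ replicate (r *ℕ m) 𝐚 ++ W (suc n)
  peel-block m n = begin
    replicate (r *ℕ suc m ∸ 1) 𝐚 ++ 𝐛 ∷ W n                    ≡⟨ P.cong (λ x → replicate x 𝐚 ++ 𝐛 ∷ W n) r[m+1]-1 ⟩
    replicate (r *ℕ m +ℕ (r ∸ 1)) 𝐚 ++ 𝐛 ∷ W n                 ≡⟨ P.cong (_++ 𝐛 ∷ W n) (replicate-+ (r *ℕ m) (r ∸ 1) 𝐚) ⟩
    (replicate (r *ℕ m) 𝐚 ++ replicate (r ∸ 1) 𝐚) ++ 𝐛 ∷ W n   ≡⟨ ListP.++-assoc (replicate (r *ℕ m) 𝐚) (replicate (r ∸ 1) 𝐚) (𝐛 ∷ W n) ⟩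
    replicate (r *ℕ m) 𝐚 ++ replicate (r ∸ 1) 𝐚 ++ 𝐛 ∷ W n     ≡⟨ P.cong (replicate (r *ℕ m) 𝐚 ++_) regroup ⟩
    replicate (r *ℕ m) 𝐚 ++ W (suc n)                          ∎
    where
    r[m+1]-1 : r *ℕ suc m ∸ 1 ≡ r *ℕ m +ℕ (r ∸ 1)
    r[m+1]-1 = P.trans (P.cong (_∸ 1) (ℕP.*-suc r m))
                 (P.trans (ℕP.+-∸-comm (r *ℕ m) r≥1) (ℕP.+-comm (r ∸ 1) (r *ℕ m)))
    regroup : replicate (r ∸ 1) 𝐚 ++ 𝐛 ∷ W n ≡ (block ++ wpow block n) ++ w
    regroup = P.sym (P.trans (ListP.++-assoc block (wpow block n) w)
                             (ListP.++-assoc (replicate (r ∸ 1) 𝐚) (𝐛 ∷ []) (W n)))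

module Proposition (r k : ℕ) (r≥1 : 1 ≤ r) (k≥1 : 1 ≤ k) (w : Word) (len-w : length w ≡ k ∸ 1) where
  open InPowerSeries
  open QBinomials
  open Descents
  open BlockWords r k r≥1 k≥1 w len-w
  open X using (Σ; δ; sign; conv; e; Σ-cong; Σ-cong′; Σ-last; Σ-*ʳ; telescope; conv-inverse)
  open XSparse using (sp; sp-cong; conv-progressions)

  T : ℕ → ℕ → Carrier
  T m n = β (replicate (r *ℕ m) 𝐚 ++ W n)

  T-recurrence : ∀ m n → β (W n) * qbinom (r *ℕ suc m) (r *ℕ n +ℕ k) ≈ T (suc m) n + T m (suc n)
  T-recurrence m n = begin
    β (W n) * qbinom (r *ℕ suc m) (r *ℕ n +ℕ k)
      ≈⟨ β (W n) *≈ reflexive (P.cong₂ qbinom (P.sym r[m+1]) (P.sym (length-W n))) ⟩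
    β (W n) * qbinom (suc (r *ℕ suc m ∸ 1)) (suc (length (W n)))
      ≈⟨ sym (β-recurrence (r *ℕ suc m ∸ 1) (W n)) ⟩
    β (replicate (suc (r *ℕ suc m ∸ 1)) 𝐚 ++ W n) + β (replicate (r *ℕ suc m ∸ 1) 𝐚 ++ 𝐛 ∷ W n)
      ≈⟨ +-cong (reflexive (P.cong (λ x → β (replicate x 𝐚 ++ W n)) r[m+1]))
                (reflexive (P.cong β (peel-block m n))) ⟩
    T (suc m) n + T m (suc n) ∎
    where
    r[m+1] : suc (r *ℕ suc m ∸ 1) ≡ r *ℕ suc m
    r[m+1] = ℕP.m+[n∸m]≡n (ℕP.*-mono-≤ r≥1 (s≤s (z≤n {m})))

  -- Σ_{n ≤ M} (-1)^n β(W n) [r(M-n) + rn + k choose r(M-n)] = β(𝐚^(rM) w),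
  -- since by T-recurrence the sum telescopes.
  alternating-sum : ∀ M → Σ (suc M) (λ n → sign n * (β (W n) * qbinom (r *ℕ (M ∸ n)) (r *ℕ n +ℕ k))) ≈ T M 0
  alternating-sum M = begin
    Σ (suc M) f                                      ≈⟨ Σ-last M f ⟩
    Σ M f + f M                                      ≈⟨ +-cong (Σ-cong M pair) last ⟩
    Σ M (λ n → sign n * (a n + a (suc n))) + sign M * a M ≈⟨ telescope M a ⟩
    a 0                                              ∎
    where
    f : ℕ → Carrier
    f n = sign n * (β (W n) * qbinom (r *ℕ (M ∸ n)) (r *ℕ n +ℕ k))
    a : ℕ → Carrier
    a n = T (M ∸ n) n
    pair : ∀ n → n < M → f n ≈ sign n * (a n + a (suc n))
    pair n n<M = begin
      sign n * (β (W n) * qbinom (r *ℕ (M ∸ n)) (r *ℕ n +ℕ k))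
        ≈⟨ reflexive (P.cong (λ x → sign n * (β (W n) * qbinom (r *ℕ x) (r *ℕ n +ℕ k))) M-n) ⟩
      sign n * (β (W n) * qbinom (r *ℕ suc (M ∸ suc n)) (r *ℕ n +ℕ k))
        ≈⟨ sign n *≈ T-recurrence (M ∸ suc n) n ⟩
      sign n * (T (suc (M ∸ suc n)) n + T (M ∸ suc n) (suc n))
        ≈⟨ reflexive (P.cong (λ x → sign n * (T x n + T (M ∸ suc n) (suc n))) (P.sym M-n)) ⟩
      sign n * (a n + a (suc n)) ∎
      where
      M-n : M ∸ n ≡ suc (M ∸ suc n)
      M-n = ℕP.+-∸-assoc 1 n<M
    r[M-M]≡0 : r *ℕ (M ∸ M) ≡ 0
    r[M-M]≡0 = P.trans (P.cong (r *ℕ_) (ℕP.n∸n≡0 M)) (ℕP.*-zeroʳ r)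
    last : f M ≈ sign M * a M
    last = sign M *≈ (begin
      β (W M) * qbinom (r *ℕ (M ∸ M)) (r *ℕ M +ℕ k) ≈⟨ β (W M) *≈ reflexive (P.cong (λ x → qbinom x (r *ℕ M +ℕ k)) r[M-M]≡0) ⟩
      β (W M) * 1#                                  ≈⟨ *-identityʳ (β (W M)) ⟩
      β (W M)                                       ≈⟨ reflexive (P.cong (λ x → β (replicate x 𝐚 ++ W M)) (P.sym r[M-M]≡0)) ⟩
      T (M ∸ M) M                                   ∎)

  cL cB cC : ℕ → Frac
  cL n = signQ n (divQFact (βq (W n)) (r *ℕ n +ℕ k))
  cB n = divQFact (βq (replicate (r *ℕ n) 𝐚 ++ w)) (r *ℕ n +ℕ k)
  cC n = divQFact 1Q (r *ℕ n)

  ℓ γ ζ : ℕ → Carrier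
  ℓ n = ev (cL n)
  γ n = ev (cB n)
  ζ n = ev (cC n)

  -- The identity of coefficient sequences (Σ_n ℓ n y^n)(Σ_m ζ m y^m) = Σ_M γ M y^M,
  -- cleared of denominators by [rM + k]!: it is alternating-sum.
  coefficient-identity : ∀ M → conv ℓ ζ M ≈ γ M
  coefficient-identity M = cancelʳ (conv ℓ ζ M) (γ M) (fact (r *ℕ M +ℕ k)) P.refl (begin
    conv ℓ ζ M * fact (r *ℕ M +ℕ k)
      ≈⟨ Σ-*ʳ (suc M) (fact (r *ℕ M +ℕ k)) (λ n → ℓ n * ζ (M ∸ n)) ⟩
    Σ (suc M) (λ n → ℓ n * ζ (M ∸ n) * fact (r *ℕ M +ℕ k))
      ≈⟨ Σ-cong (suc M) (λ n n≤M → term n (ℕP.≤-pred n≤M)) ⟩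
    Σ (suc M) (λ n → sign n * (β (W n) * qbinom (r *ℕ (M ∸ n)) (r *ℕ n +ℕ k)))
      ≈⟨ alternating-sum M ⟩
    T M 0
      ≈⟨ sym γ-cleared ⟩
    γ M * fact (r *ℕ M +ℕ k) ∎)
    where
    F = fact (r *ℕ M +ℕ k)
    γ-cleared : γ M * F ≈ T M 0
    γ-cleared = begin
      γ M * F                                ≈⟨ ev-divQFact (βq (replicate (r *ℕ M) 𝐚 ++ w)) (r *ℕ M +ℕ k) ≈* F ⟩
      ev (βq (replicate (r *ℕ M) 𝐚 ++ w)) * recip F * F
                                             ≈⟨ *-assoc (ev (βq (replicate (r *ℕ M) 𝐚 ++ w))) (recip F) F ⟩
      ev (βq (replicate (r *ℕ M) 𝐚 ++ w)) * (recip F * F)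
                                             ≈⟨ *-cong (ev-polyQ (betaPoly (replicate (r *ℕ M) 𝐚 ++ w)))
                                                       (trans (*-comm (recip F) F) (recip-inverse F P.refl)) ⟩
      T M 0 * 1#                             ≈⟨ *-identityʳ (T M 0) ⟩
      T M 0                                  ∎
    indices : ∀ n → n ≤ M → r *ℕ (M ∸ n) +ℕ (r *ℕ n +ℕ k) ≡ r *ℕ M +ℕ k
    indices n n≤M = P.trans (P.sym (ℕP.+-assoc (r *ℕ (M ∸ n)) (r *ℕ n) k))
      (P.cong (_+ℕ k) (P.trans (P.sym (ℕP.*-distribˡ-+ r (M ∸ n) n)) (P.cong (r *ℕ_) (ℕP.m∸n+n≡m n≤M))))
    term : ∀ n → n ≤ M → ℓ n * ζ (M ∸ n) * fact (r *ℕ M +ℕ k)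
                         ≈ sign n * (β (W n) * qbinom (r *ℕ (M ∸ n)) (r *ℕ n +ℕ k))
    term n n≤M = begin
      ℓ n * ζ (M ∸ n) * fact (r *ℕ M +ℕ k)
        ≈⟨ *-cong (trans (ev-signQ n _) (sign n *≈ trans (ev-divQFact (βq (W n)) (r *ℕ n +ℕ k))
                                                           (ev-polyQ (betaPoly (W n)) ≈* recip (fact (r *ℕ n +ℕ k)))))
                          (trans (ev-divQFact 1Q (r *ℕ (M ∸ n))) (ev-1Q ≈* recip (fact (r *ℕ (M ∸ n)))))
           ≈* fact (r *ℕ M +ℕ k) ⟩
      (sign n * (β (W n) * recip (fact (r *ℕ n +ℕ k)))) * (1# * recip (fact (r *ℕ (M ∸ n)))) * fact (r *ℕ M +ℕ k)
        ≈⟨ solve 5 (λ s b I J F → ((s :* (b :* I)) :* (con 1 :* J)) :* F := s :* (b :* (F :* (J :* I)))) refl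
                 (sign n) (β (W n)) (recip (fact (r *ℕ n +ℕ k))) (recip (fact (r *ℕ (M ∸ n)))) (fact (r *ℕ M +ℕ k)) ⟩
      sign n * (β (W n) * (fact (r *ℕ M +ℕ k) * (recip (fact (r *ℕ (M ∸ n))) * recip (fact (r *ℕ n +ℕ k)))))
        ≈⟨ sign n *≈ (β (W n) *≈ sym (trans (qbinom-ratio (r *ℕ (M ∸ n)) (r *ℕ n +ℕ k))
              (reflexive (P.cong (λ x → fact x * (recip (fact (r *ℕ (M ∸ n))) * recip (fact (r *ℕ n +ℕ k)))) (indices n n≤M))))) ⟩
      sign n * (β (W n) * qbinom (r *ℕ (M ∸ n)) (r *ℕ n +ℕ k)) ∎

  e₁ : ℕ → ℕ
  e₁ n = r *ℕ n +ℕ k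

  L B C : Series
  L = sparse e₁ cL
  B = sparse e₁ cB
  C = sparse (r *ℕ_) cC

  product : ∀ N → conv (λ i → ev (L i)) (λ i → ev (C i)) N ≈ ev (B N)
  product N = begin
    conv (λ i → ev (L i)) (λ i → ev (C i)) N ≈⟨ X.conv-cong (ev-sparse e₁ cL) (ev-sparse (r *ℕ_) cC) N ⟩
    conv (sp e₁ ℓ) (sp (r *ℕ_) ζ) N          ≈⟨ conv-progressions r k ℓ ζ r≥1 N ⟩
    sp e₁ (conv ℓ ζ) N                       ≈⟨ sp-cong e₁ coefficient-identity N ⟩
    sp e₁ γ N                                ≈⟨ sym (ev-sparse e₁ cB N) ⟩
    ev (B N)                                 ∎

  C-inverse : ∀ N → conv (λ i → ev (C i)) (λ i → ev (inv1 C i)) N ≈ e N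
  C-inverse = conv-inverse (λ i → ev (C i)) (λ i → ev (inv1 C i)) C₀≈1 ev-1Q (ev-inv1 C)
    where
    r*0≡0 : r *ℕ 0 ≡ 0
    r*0≡0 = ℕP.*-zeroʳ r
    ζ₀≈1 : ζ 0 ≈ 1#
    ζ₀≈1 = begin
      ζ 0                           ≈⟨ ev-divQFact 1Q (r *ℕ 0) ⟩
      ev 1Q * recip (fact (r *ℕ 0)) ≈⟨ *-cong ev-1Q (reflexive (P.cong (λ x → recip (fact x)) r*0≡0)) ⟩
      1# * recip (fact 0)           ≈⟨ *-identityˡ (recip (fact 0)) ⟩
      recip (fact 0)                ≈⟨ recip-cong (fact 0) 1# P.refl P.refl ⟦1⟧ ⟩
      recip 1#                      ≈⟨ recip-1 ⟩
      1#                            ∎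
    C₀≈1 : ev (C 0) ≈ 1#
    C₀≈1 = begin
      ev (C 0)                      ≈⟨ ev-sparse (r *ℕ_) cC 0 ⟩
      δ (r *ℕ 0) 0 * ζ 0 + 0#       ≈⟨ +-identityʳ _ ⟩
      δ (r *ℕ 0) 0 * ζ 0            ≈⟨ *-cong (reflexive (P.cong (λ x → δ x 0) r*0≡0)) ζ₀≈1 ⟩
      1# * 1#                       ≈⟨ *-identityˡ 1# ⟩
      1#                            ∎

open import Data.Nat using (_+_; _*_)

proposition5p3 : (r k : ℕ) → 1 ≤ r → 1 ≤ k → (w : Word) → length w ≡ k ∸ 1 →
    sparse (λ n → r * n + k)
           (λ n → signQ n (divQFact (βq (wpow (replicate (r ∸ 1) 𝐚 ++ 𝐛 ∷ []) n ++ w)) (r * n + k)))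
    ≋ (sparse (λ n → r * n + k) (λ n → divQFact (βq (replicate (r * n) 𝐚 ++ w)) (r * n + k))
       ⊘ sparse (λ n → r * n) (λ n → divQFact 1Q (r * n)))
proposition5p3 r k r≥1 k≥1 w len-w N = ev-faithful (L N) ((B ⊛ inv1 C) N) (begin
  ev (L N)                                       ≈⟨ X.conv-divide (ev ∘ L) (ev ∘ C) (ev ∘ B) (ev ∘ inv1 C) product C-inverse N ⟩
  X.conv (ev ∘ B) (ev ∘ inv1 C) N                ≈⟨ sym (ev-⊛ B (inv1 C) N) ⟩
  ev ((B ⊛ inv1 C) N)                            ∎)
  where
  open Proposition r k r≥1 k≥1 w len-w using (L; B; C; product; C-inverse)
  open InPowerSeries using (ev; ev-faithful; ev-⊛; begin_; step-≈-⟩; _∎; sym)
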